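{- Every prime $p$ with $p\equiv 1 \pmod 8$ is G-irregular.
   Context: Genocchi numbers $G_n$ are defined by $\frac{2t}{e^t+1}=\sum_{n\ge 1}G_n\frac{t^n}{n!}$; an odd prime $p$ is G-irregular if it divides at least one of the integers $G_2,G_4,\ldots,G_{p-3}$. -}

module Defs where

open import Data.Nat using (ℕ; zero; suc)
open import Data.Nat.Combinatorics using (_C_)
open import Data.Integer using (ℤ; +_; _+_; _-_; _*_)
open import Data.Integer.DivMod using (_/_)
open import Data.List using (List; []; _∷_; zipWith; foldr; downFrom)

-- Genocchi numbers, defined by 2t/(e^t+1) = Σ_{n≥1} G_n t^n/n!.
-- Multiplying by (e^t+1) and comparing coefficients of t^n/n! gives
--   G_n + Σ_{k=0}^{n} (n C k) G_k = 2·[n = 1],  i.e.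
--   2 G_n = 2·[n = 1] - Σ_{k<n} (n C k) G_k   (so G_0 = 0),
-- which determines G uniquely; the division by 2 below is exact.

δ₁ : ℕ → ℤ
δ₁ 1 = + 2
δ₁ _ = + 0

next : ℕ → List ℤ → ℤ
next n gs = (δ₁ n - foldr _+_ (+ 0) (zipWith (λ k g → + (n C k) * g) (downFrom n) gs)) / + 2

-- revG n = [G_{n-1}, …, G_1, G_0]
revG : ℕ → List ℤ
revG zero = []
revG (suc n) = next n (revG n) ∷ revG n

genocchi : ℕ → ℤ
genocchi n = next n (revG n)

module Submission where

-- Every prime p ≡ 1 (mod 8) divides the Genocchi number G_{(p-1)/2}, so it is
-- G-irregular (take k = (p-1)/4 in the statement).  The route is through Genocchi
-- (Appell) polynomials, as for Kummer's congruences: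
--  * finite sums ∑, products ∏ and antidiagonal sums conv; binomial coefficients
--    B a b = C(a+b, a) with Pascal's rule, trinomial revision and the binomial theorem;
--  * Appell: if h_m + Σ_{k≤m} C(m,k) h_k = c·[m = 1], the polynomials
--    P_q(x) = Σ_{k+i=q} C(q,k) h_k x^i satisfy P_q(x+2) - P_q(x) = c q ((x+1)^{q-1} - x^{q-1});
--  * the definition of genocchi halves an integer at each index; by strong induction
--    that halving is exact, i.e. G satisfies its recurrence, and G vanishes at odd n ≥ 3
--    (the Appell identity for the numerators, evaluated at x = 0 resp. x = -1);
--  * power sums S_p(a) = Σ_{i<p} i^a are divisible by p for 1 ≤ a ≤ p - 2, and Gauss's
--    lemma gives p ∣ 2^{(p-1)/2} - 1 when p ≡ 1 (mod 8);
--  * telescoping the Appell identity over x = 0, 2, …, 2p shows p ∣ G_M whenever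
--    p ∣ 2^M - 1 and 2 ≤ M ≤ p - 2.  Taking M = (p-1)/2 gives the theorem.

open import Defs

module GenocchiDivisibility where

  open import Data.Nat as ℕ using (ℕ; zero; suc; _!)
  import Data.Nat.Properties as ℕP
  import Data.Nat.Tactic.RingSolver as ℕSolver
  import Data.Nat.Divisibility as ℕD
  open import Data.Nat.DivMod using (m≡m%n+[m/n]*n)
  open import Data.Nat.Combinatorics using (_C_; nCn≡1; nCk+nC[k+1]≡[n+1]C[k+1])
  open import Data.Nat.Primality using (Prime; euclidsLemma; prime⇒nonZero; prime⇒nonTrivial; ¬prime[1])
  open import Data.Integer as ℤ using (ℤ; +_; _+_; _*_; -_; _-_; _^_)
  open import Data.Integer.Properties
  open import Data.Integer.Tactic.RingSolver using (solve-∀)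
  open import Data.Integer.DivMod using (a≡a%n+[a/n]*n; n%d<d)
  open import Data.Integer.Divisibility.Signed as D using (_∣_)
  open import Data.Product using (∃-syntax; _×_; _,_; proj₁; proj₂)
  open import Data.Sum using (_⊎_; inj₁; inj₂)
  open import Data.Empty using (⊥-elim)
  open import Data.List using (zipWith; foldr; downFrom)
  open import Relation.Nullary using (¬_)
  open import Data.Nat.Induction using (<-rec)
  open import Relation.Binary.PropositionalEquality
  open ≡-Reasoning

  ∑ : ℕ → (ℕ → ℤ) → ℤ
  ∑ zero f = + 0
  ∑ (suc n) f = ∑ n f + f n

  ∑-cong : ∀ n {f g : ℕ → ℤ} → (∀ i → i ℕ.< n → f i ≡ g i) → ∑ n f ≡ ∑ n g
  ∑-cong zero eq = refl
  ∑-cong (suc n) eq = cong₂ _+_ (∑-cong n (λ i i<n → eq i (ℕP.m<n⇒m<1+n i<n))) (eq n ℕP.≤-refl)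

  ∑-+ : ∀ n (f g : ℕ → ℤ) → ∑ n (λ i → f i + g i) ≡ ∑ n f + ∑ n g
  ∑-+ zero f g = refl
  ∑-+ (suc n) f g rewrite ∑-+ n f g = interchange (∑ n f) (∑ n g) (f n) (g n)
    where
    interchange : ∀ (a b c d : ℤ) → a + b + (c + d) ≡ a + c + (b + d)
    interchange = solve-∀

  ∑-neg : ∀ n (f : ℕ → ℤ) → ∑ n (λ i → - f i) ≡ - ∑ n f
  ∑-neg zero f = refl
  ∑-neg (suc n) f rewrite ∑-neg n f = sym (neg-distrib-+ (∑ n f) (f n))

  ∑-- : ∀ n (f g : ℕ → ℤ) → ∑ n (λ i → f i - g i) ≡ ∑ n f - ∑ n g
  ∑-- n f g = trans (∑-+ n f (λ i → - g i)) (cong (_+_ (∑ n f)) (∑-neg n g))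

  ∑-*ˡ : ∀ n (c : ℤ) (f : ℕ → ℤ) → ∑ n (λ i → c * f i) ≡ c * ∑ n f
  ∑-*ˡ zero c f = sym (*-zeroʳ c)
  ∑-*ˡ (suc n) c f rewrite ∑-*ˡ n c f = sym (*-distribˡ-+ c _ _)

  ∑-ones : ∀ n → ∑ n (λ _ → + 1) ≡ + n
  ∑-ones zero = refl
  ∑-ones (suc n) rewrite ∑-ones n = cong +_ (ℕP.+-comm n 1)

  ∑-shift : ∀ n (f : ℕ → ℤ) → ∑ (suc n) f ≡ f 0 + ∑ n (λ i → f (suc i))
  ∑-shift zero f = +-comm (+ 0) (f 0)
  ∑-shift (suc n) f rewrite ∑-shift n f = +-assoc (f 0) (∑ n (λ i → f (suc i))) (f (suc n))

  ∑-split : ∀ m n (f : ℕ → ℤ) → ∑ (m ℕ.+ n) f ≡ ∑ m f + ∑ n (λ i → f (m ℕ.+ i))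
  ∑-split m zero f rewrite ℕP.+-identityʳ m = sym (+-identityʳ _)
  ∑-split m (suc n) f rewrite ℕP.+-suc m n | ∑-split m n f = +-assoc (∑ m f) (∑ n (λ i → f (m ℕ.+ i))) (f (m ℕ.+ n))

  ∑-pairs : ∀ n (f : ℕ → ℤ) → ∑ (n ℕ.* 2) f ≡ ∑ n (λ i → f (i ℕ.* 2) + f (suc (i ℕ.* 2)))
  ∑-pairs zero f = refl
  ∑-pairs (suc n) f rewrite ∑-pairs n f = +-assoc (∑ n (λ i → f (i ℕ.* 2) + f (suc (i ℕ.* 2)))) (f (n ℕ.* 2)) (f (suc (n ℕ.* 2)))

  ∑-telescope : ∀ n (f : ℕ → ℤ) → ∑ n (λ i → f (suc i) - f i) ≡ f n - f 0
  ∑-telescope zero f = sym (+-inverseʳ (f 0))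
  ∑-telescope (suc n) f rewrite ∑-telescope n f = collapse (f n) (f 0) (f (suc n))
    where
    collapse : ∀ a b c → a - b + (c - a) ≡ c - b
    collapse = solve-∀

  ∑-∣ : ∀ n {d : ℤ} {f : ℕ → ℤ} → (∀ i → i ℕ.< n → d ∣ f i) → d ∣ ∑ n f
  ∑-∣ zero _ = D.divides (+ 0) refl
  ∑-∣ (suc n) d∣f = D.∣m∣n⇒∣m+n (∑-∣ n (λ i i<n → d∣f i (ℕP.m<n⇒m<1+n i<n))) (d∣f n ℕP.≤-refl)

  -- Sums over the antidiagonal, conv n F = Σ_{a+b=n} F a b; these are the coefficient
  -- sums of products of exponential generating functions.
  conv : ℕ → (ℕ → ℕ → ℤ) → ℤ
  conv zero F = F 0 0
  conv (suc n) F = F 0 (suc n) + conv n (λ a b → F (suc a) b)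

  conv-cong : ∀ n {F G : ℕ → ℕ → ℤ} → (∀ a b → a ℕ.+ b ≡ n → F a b ≡ G a b) → conv n F ≡ conv n G
  conv-cong zero eq = eq 0 0 refl
  conv-cong (suc n) eq = cong₂ _+_ (eq 0 (suc n) refl) (conv-cong n (λ a b e → eq (suc a) b (cong suc e)))

  conv-+ : ∀ n (F G : ℕ → ℕ → ℤ) → conv n (λ a b → F a b + G a b) ≡ conv n F + conv n G
  conv-+ zero F G = refl
  conv-+ (suc n) F G rewrite conv-+ n (λ a b → F (suc a) b) (λ a b → G (suc a) b) =
    interchange (F 0 (suc n)) (G 0 (suc n)) (conv n (λ a b → F (suc a) b)) (conv n (λ a b → G (suc a) b))
    where
    interchange : ∀ (a b c d : ℤ) → a + b + (c + d) ≡ a + c + (b + d)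
    interchange = solve-∀

  conv-*ˡ : ∀ n (c : ℤ) (F : ℕ → ℕ → ℤ) → conv n (λ a b → c * F a b) ≡ c * conv n F
  conv-*ˡ zero c F = refl
  conv-*ˡ (suc n) c F rewrite conv-*ˡ n c (λ a b → F (suc a) b) = sym (*-distribˡ-+ c _ _)

  conv-neg : ∀ n (F : ℕ → ℕ → ℤ) → conv n (λ a b → - F a b) ≡ - conv n F
  conv-neg zero F = refl
  conv-neg (suc n) F rewrite conv-neg n (λ a b → F (suc a) b) = sym (neg-distrib-+ (F 0 (suc n)) (conv n (λ a b → F (suc a) b)))

  conv-- : ∀ n (F G : ℕ → ℕ → ℤ) → conv n (λ a b → F a b - G a b) ≡ conv n F - conv n G
  conv-- n F G = trans (conv-+ n F (λ a b → - G a b)) (cong (_+_ (conv n F)) (conv-neg n G))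

  conv-zero : ∀ n → conv n (λ _ _ → + 0) ≡ + 0
  conv-zero zero = refl
  conv-zero (suc n) rewrite conv-zero n = refl

  conv-snoc : ∀ n (F : ℕ → ℕ → ℤ) → conv (suc n) F ≡ conv n (λ a b → F a (suc b)) + F (suc n) 0
  conv-snoc zero F = refl
  conv-snoc (suc n) F rewrite conv-snoc n (λ a b → F (suc a) b) =
    sym (+-assoc (F 0 (suc (suc n))) (conv n (λ a b → F (suc a) (suc b))) (F (suc (suc n)) 0))

  conv-comm : ∀ n (F : ℕ → ℕ → ℤ) → conv n F ≡ conv n (λ a b → F b a)
  conv-comm zero F = refl
  conv-comm (suc n) F rewrite conv-snoc n (λ a b → F b a) | conv-comm n (λ a b → F (suc a) b) =
    +-comm (F 0 (suc n)) (conv n (λ a b → F (suc b) a))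

  -- Both sides sum F a b c over all a + b + c = n.
  conv-assoc : ∀ n (F : ℕ → ℕ → ℕ → ℤ) →
    conv n (λ a r → conv r (λ b c → F a b c)) ≡ conv n (λ s c → conv s (λ a b → F a b c))
  conv-assoc zero F = refl
  conv-assoc (suc n) F =
    begin
      conv (suc n) (λ b c → F 0 b c) + conv n (λ a r → conv r (λ b c → F (suc a) b c))
    ≡⟨ cong (_+_ (conv (suc n) (λ b c → F 0 b c))) (conv-assoc n (λ a b c → F (suc a) b c)) ⟩
      (F 0 0 (suc n) + conv n (λ b c → F 0 (suc b) c)) + conv n (λ s c → conv s (λ a b → F (suc a) b c))
    ≡⟨ +-assoc (F 0 0 (suc n)) (conv n (λ b c → F 0 (suc b) c)) (conv n (λ s c → conv s (λ a b → F (suc a) b c))) ⟩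
      F 0 0 (suc n) + (conv n (λ b c → F 0 (suc b) c) + conv n (λ s c → conv s (λ a b → F (suc a) b c)))
    ≡⟨ cong (_+_ (F 0 0 (suc n))) (conv-+ n (λ b c → F 0 (suc b) c) (λ s c → conv s (λ a b → F (suc a) b c))) ⟨
      F 0 0 (suc n) + conv n (λ s c → F 0 (suc s) c + conv s (λ a b → F (suc a) b c))
    ∎

  ∑-conv : ∀ N m (F : ℕ → ℕ → ℕ → ℤ) → ∑ N (λ i → conv m (F i)) ≡ conv m (λ a b → ∑ N (λ i → F i a b))
  ∑-conv zero m F = sym (conv-zero m)
  ∑-conv (suc N) m F rewrite ∑-conv N m F = sym (conv-+ m _ _)

  conv-as-∑ : ∀ n (F : ℕ → ℕ → ℤ) → conv n F ≡ ∑ (suc n) (λ a → F a (n ℕ.∸ a))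
  conv-as-∑ zero F = sym (+-identityˡ (F 0 0))
  conv-as-∑ (suc n) F rewrite conv-as-∑ n (λ a b → F (suc a) b) = sym (∑-shift (suc n) (λ a → F a (suc n ℕ.∸ a)))

  conv-∣ : ∀ n {d : ℤ} {F : ℕ → ℕ → ℤ} → (∀ a b → a ℕ.+ b ≡ n → d ∣ F a b) → d ∣ conv n F
  conv-∣ zero d∣F = d∣F 0 0 refl
  conv-∣ (suc n) d∣F = D.∣m∣n⇒∣m+n (d∣F 0 (suc n) refl) (conv-∣ n (λ a b e → d∣F (suc a) b (cong suc e)))

  ∏ : ℕ → (ℕ → ℤ) → ℤ
  ∏ zero f = + 1
  ∏ (suc n) f = ∏ n f * f n

  ∏-cong : ∀ n {f g : ℕ → ℤ} → (∀ i → i ℕ.< n → f i ≡ g i) → ∏ n f ≡ ∏ n g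
  ∏-cong zero eq = refl
  ∏-cong (suc n) eq = cong₂ _*_ (∏-cong n (λ i i<n → eq i (ℕP.m<n⇒m<1+n i<n))) (eq n ℕP.≤-refl)

  ∏-split : ∀ m n (f : ℕ → ℤ) → ∏ (m ℕ.+ n) f ≡ ∏ m f * ∏ n (λ i → f (m ℕ.+ i))
  ∏-split m zero f rewrite ℕP.+-identityʳ m = sym (*-identityʳ _)
  ∏-split m (suc n) f rewrite ℕP.+-suc m n | ∏-split m n f = *-assoc (∏ m f) (∏ n (λ i → f (m ℕ.+ i))) (f (m ℕ.+ n))

  ∏-shift : ∀ n (f : ℕ → ℤ) → ∏ (suc n) f ≡ f 0 * ∏ n (λ i → f (suc i))
  ∏-shift zero f = *-comm (+ 1) (f 0)
  ∏-shift (suc n) f rewrite ∏-shift n f = *-assoc (f 0) (∏ n (λ i → f (suc i))) (f (suc n))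

  ∏-reverse : ∀ n (f : ℕ → ℤ) → ∏ n f ≡ ∏ n (λ i → f (n ℕ.∸ suc i))
  ∏-reverse zero f = refl
  ∏-reverse (suc n) f rewrite ∏-shift n (λ i → f (suc n ℕ.∸ suc i)) | sym (∏-reverse n f) = *-comm (∏ n f) (f n)

  ∏-pairs : ∀ n (f : ℕ → ℤ) → ∏ (n ℕ.* 2) f ≡ ∏ n (λ i → f (i ℕ.* 2) * f (suc (i ℕ.* 2)))
  ∏-pairs zero f = refl
  ∏-pairs (suc n) f rewrite ∏-pairs n f = *-assoc (∏ n (λ i → f (i ℕ.* 2) * f (suc (i ℕ.* 2)))) (f (n ℕ.* 2)) (f (suc (n ℕ.* 2)))

  ∏-* : ∀ n (f g : ℕ → ℤ) → ∏ n (λ i → f i * g i) ≡ ∏ n f * ∏ n g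
  ∏-* zero f g = refl
  ∏-* (suc n) f g rewrite ∏-* n f g = interchange (∏ n f) (∏ n g) (f n) (g n)
    where
    interchange : ∀ a b c d → a * b * (c * d) ≡ a * c * (b * d)
    interchange = solve-∀

  ∏-*ˡ : ∀ n (c : ℤ) (f : ℕ → ℤ) → ∏ n (λ i → c * f i) ≡ c ^ n * ∏ n f
  ∏-*ˡ n c f = trans (∏-* n (λ _ → c) f) (cong (_* ∏ n f) (∏-const n))
    where
    ∏-const : ∀ n → ∏ n (λ _ → c) ≡ c ^ n
    ∏-const zero = refl
    ∏-const (suc n) rewrite ∏-const n = *-comm (c ^ n) c

  ∏-congruent : ∀ n {d : ℤ} (f g : ℕ → ℤ) → (∀ i → i ℕ.< n → d ∣ f i - g i) → d ∣ ∏ n f - ∏ n g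
  ∏-congruent zero f g _ = D.divides (+ 0) refl
  ∏-congruent (suc n) f g d∣f-g =
    subst (_ ∣_) (expand (∏ n f) (∏ n g) (f n) (g n))
      (D.∣m∣n⇒∣m+n (D.∣n⇒∣m*n (∏ n f) (d∣f-g n ℕP.≤-refl))
                   (D.∣m⇒∣m*n (g n) (∏-congruent n f g (λ i i<n → d∣f-g i (ℕP.m<n⇒m<1+n i<n)))))
    where
    expand : ∀ a b c d → a * (c - d) + (a - b) * d ≡ a * c - b * d
    expand = solve-∀

  -- Binomial coefficients indexed by the two parts: B a b = (a + b choose a).
  -- Pascal's rule is the defining recursion, which makes B fit the antidiagonal sums.
  B : ℕ → ℕ → ℕ
  B zero b = 1
  B (suc a) zero = 1
  B (suc a) (suc b) = B a (suc b) ℕ.+ B (suc a) b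

  B-zeroʳ : ∀ a → B a 0 ≡ 1
  B-zeroʳ zero = refl
  B-zeroʳ (suc a) = refl

  B-sym : ∀ a b → B a b ≡ B b a
  B-sym zero zero = refl
  B-sym zero (suc b) = refl
  B-sym (suc a) zero = refl
  B-sym (suc a) (suc b) rewrite B-sym a (suc b) | B-sym (suc a) b = ℕP.+-comm (B (suc b) a) (B b (suc a))

  B-oneʳ : ∀ a → B a 1 ≡ suc a
  B-oneʳ zero = refl
  B-oneʳ (suc a) rewrite B-oneʳ a = ℕP.+-comm (suc a) 1

  B-C : ∀ a b → (a ℕ.+ b) C a ≡ B a b
  B-C zero b = refl
  B-C (suc a) zero rewrite ℕP.+-identityʳ a = nCn≡1 (suc a)
  B-C (suc a) (suc b) =
    begin
      suc (a ℕ.+ suc b) C suc a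
    ≡⟨ nCk+nC[k+1]≡[n+1]C[k+1] (a ℕ.+ suc b) a ⟨
      (a ℕ.+ suc b) C a ℕ.+ (a ℕ.+ suc b) C suc a
    ≡⟨ cong (λ z → (a ℕ.+ suc b) C a ℕ.+ z C suc a) (ℕP.+-suc a b) ⟩
      (a ℕ.+ suc b) C a ℕ.+ (suc a ℕ.+ b) C suc a
    ≡⟨ cong₂ ℕ._+_ (B-C a (suc b)) (B-C (suc a) b) ⟩
      B a (suc b) ℕ.+ B (suc a) b
    ∎

  B-factorial : ∀ a b → B a b ℕ.* (a ! ℕ.* b !) ≡ (a ℕ.+ b) !
  B-factorial zero b = trans (ℕP.+-identityʳ (b ! ℕ.+ 0)) (ℕP.+-identityʳ (b !))
  B-factorial (suc a) zero rewrite ℕP.+-identityʳ a = trans (ℕP.+-identityʳ _) (ℕP.*-identityʳ _)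
  B-factorial (suc a) (suc b) =
    begin
      (B a (suc b) ℕ.+ B (suc a) b) ℕ.* (suc a ! ℕ.* suc b !)
    ≡⟨ split (B a (suc b)) (B (suc a) b) a b (a !) (b !) ⟩
      suc a ℕ.* (B a (suc b) ℕ.* (a ! ℕ.* suc b !)) ℕ.+ suc b ℕ.* (B (suc a) b ℕ.* (suc a ! ℕ.* b !))
    ≡⟨ cong₂ (λ u v → suc a ℕ.* u ℕ.+ suc b ℕ.* v) (B-factorial a (suc b)) (B-factorial (suc a) b) ⟩
      suc a ℕ.* (a ℕ.+ suc b) ! ℕ.+ suc b ℕ.* suc (a ℕ.+ b) !
    ≡⟨ cong (λ z → suc a ℕ.* z ! ℕ.+ suc b ℕ.* suc (a ℕ.+ b) !) (ℕP.+-suc a b) ⟩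
      suc a ℕ.* suc (a ℕ.+ b) ! ℕ.+ suc b ℕ.* suc (a ℕ.+ b) !
    ≡⟨ collect a b (suc (a ℕ.+ b) !) ⟩
      suc (suc (a ℕ.+ b)) ℕ.* suc (a ℕ.+ b) !
    ≡⟨ cong (λ z → suc z ℕ.* z !) (ℕP.+-suc a b) ⟨
      (suc a ℕ.+ suc b) !
    ∎
    where
    split : ∀ x y a b fa fb → (x ℕ.+ y) ℕ.* ((suc a ℕ.* fa) ℕ.* (suc b ℕ.* fb))
                             ≡ suc a ℕ.* (x ℕ.* (fa ℕ.* (suc b ℕ.* fb))) ℕ.+ suc b ℕ.* (y ℕ.* ((suc a ℕ.* fa) ℕ.* fb))
    split = ℕSolver.solve-∀
    collect : ∀ a b f → suc a ℕ.* f ℕ.+ suc b ℕ.* f ≡ suc (suc (a ℕ.+ b)) ℕ.* f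
    collect = ℕSolver.solve-∀

  -- Trinomial revision: both sides are the multinomial coefficient (k + j + l)! / (k! j! l!).
  B-trinomial : ∀ k j l → B k (j ℕ.+ l) ℕ.* B j l ≡ B j (k ℕ.+ l) ℕ.* B k l
  B-trinomial k j l =
    ℕP.*-cancelʳ-≡ _ _ (k ! ℕ.* j ! ℕ.* l !) {{ℕP.m*n≢0 _ _ {{ℕP.m*n≢0 _ _ {{k ℕP.!≢0}} {{j ℕP.!≢0}}}} {{l ℕP.!≢0}}}}
      (begin
        B k (j ℕ.+ l) ℕ.* B j l ℕ.* (k ! ℕ.* j ! ℕ.* l !)
      ≡⟨ regroup₁ (B k (j ℕ.+ l)) (B j l) (k !) (j !) (l !) ⟩
        B k (j ℕ.+ l) ℕ.* (k ! ℕ.* (B j l ℕ.* (j ! ℕ.* l !)))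
      ≡⟨ cong (λ z → B k (j ℕ.+ l) ℕ.* (k ! ℕ.* z)) (B-factorial j l) ⟩
        B k (j ℕ.+ l) ℕ.* (k ! ℕ.* (j ℕ.+ l) !)
      ≡⟨ B-factorial k (j ℕ.+ l) ⟩
        (k ℕ.+ (j ℕ.+ l)) !
      ≡⟨ cong _! (reorder k j l) ⟩
        (j ℕ.+ (k ℕ.+ l)) !
      ≡⟨ B-factorial j (k ℕ.+ l) ⟨
        B j (k ℕ.+ l) ℕ.* (j ! ℕ.* (k ℕ.+ l) !)
      ≡⟨ cong (λ z → B j (k ℕ.+ l) ℕ.* (j ! ℕ.* z)) (B-factorial k l) ⟨
        B j (k ℕ.+ l) ℕ.* (j ! ℕ.* (B k l ℕ.* (k ! ℕ.* l !)))
      ≡⟨ regroup₂ (B j (k ℕ.+ l)) (B k l) (k !) (j !) (l !) ⟩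
        B j (k ℕ.+ l) ℕ.* B k l ℕ.* (k ! ℕ.* j ! ℕ.* l !)
      ∎)
    where
    regroup₁ : ∀ x y a b c → x ℕ.* y ℕ.* (a ℕ.* b ℕ.* c) ≡ x ℕ.* (a ℕ.* (y ℕ.* (b ℕ.* c)))
    regroup₁ = ℕSolver.solve-∀
    regroup₂ : ∀ x y a b c → x ℕ.* (b ℕ.* (y ℕ.* (a ℕ.* c))) ≡ x ℕ.* y ℕ.* (a ℕ.* b ℕ.* c)
    regroup₂ = ℕSolver.solve-∀
    reorder : ∀ k j l → k ℕ.+ (j ℕ.+ l) ≡ j ℕ.+ (k ℕ.+ l)
    reorder = ℕSolver.solve-∀

  pascal : ∀ n (H : ℕ → ℕ → ℤ) →
    conv (suc n) (λ a b → + B a b * H a b)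
      ≡ conv n (λ a b → + B a b * H (suc a) b) + conv n (λ a b → + B a b * H a (suc b))
  pascal zero H rewrite *-identityˡ (H 0 1) | *-identityˡ (H 1 0) = +-comm (H 0 1) (H 1 0)
  pascal (suc n) H =
    begin
      + 1 * H 0 (suc (suc n)) + conv (suc n) (λ a b → + B (suc a) b * H (suc a) b)
    ≡⟨ cong (_+_ (+ 1 * H 0 (suc (suc n)))) (conv-snoc n (λ a b → + B (suc a) b * H (suc a) b)) ⟩
      + 1 * H 0 (suc (suc n)) + (conv n (λ a b → + (B a (suc b) ℕ.+ B (suc a) b) * H (suc a) (suc b)) + + B (suc (suc n)) 0 * H (suc (suc n)) 0)
    ≡⟨ cong₂ (λ u v → + 1 * H 0 (suc (suc n)) + (u + + v * H (suc (suc n)) 0))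
         (trans (conv-cong n (λ a b _ → trans (cong (_* H (suc a) (suc b)) (pos-+ (B a (suc b)) (B (suc a) b)))
                                               (*-distribʳ-+ (H (suc a) (suc b)) (+ B a (suc b)) (+ B (suc a) b))))
                (conv-+ n (λ a b → + B a (suc b) * H (suc a) (suc b)) (λ a b → + B (suc a) b * H (suc a) (suc b))))
         (trans (B-zeroʳ (suc (suc n))) (sym (B-zeroʳ (suc n)))) ⟩
      + 1 * H 0 (suc (suc n)) + (conv n (λ a b → + B a (suc b) * H (suc a) (suc b)) + conv n (λ a b → + B (suc a) b * H (suc a) (suc b)) + + B (suc n) 0 * H (suc (suc n)) 0)
    ≡⟨ regroup (+ 1 * H 0 (suc (suc n))) (conv n (λ a b → + B a (suc b) * H (suc a) (suc b))) (conv n (λ a b → + B (suc a) b * H (suc a) (suc b))) (+ B (suc n) 0 * H (suc (suc n)) 0) ⟩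
      (conv n (λ a b → + B a (suc b) * H (suc a) (suc b)) + + B (suc n) 0 * H (suc (suc n)) 0) + (+ 1 * H 0 (suc (suc n)) + conv n (λ a b → + B (suc a) b * H (suc a) (suc b)))
    ≡⟨ cong (_+ (+ 1 * H 0 (suc (suc n)) + conv n (λ a b → + B (suc a) b * H (suc a) (suc b)))) (conv-snoc n (λ a b → + B a b * H (suc a) b)) ⟨
      conv (suc n) (λ a b → + B a b * H (suc a) b) + conv (suc n) (λ a b → + B a b * H a (suc b))
    ∎
    where
    regroup : ∀ (a b c d : ℤ) → a + (b + c + d) ≡ (b + d) + (a + c)
    regroup = solve-∀

  binomial : ∀ (x : ℤ) i → (x + + 1) ^ i ≡ conv i (λ a b → + B a b * x ^ a)
  binomial x zero = refl
  binomial x (suc i) =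
    begin
      (x + + 1) * (x + + 1) ^ i
    ≡⟨ cong ((x + + 1) *_) (binomial x i) ⟩
      (x + + 1) * conv i (λ a b → + B a b * x ^ a)
    ≡⟨ *-distribʳ-+ (conv i (λ a b → + B a b * x ^ a)) x (+ 1) ⟩
      x * conv i (λ a b → + B a b * x ^ a) + + 1 * conv i (λ a b → + B a b * x ^ a)
    ≡⟨ cong₂ _+_ (trans (sym (conv-*ˡ i x _)) (conv-cong i (λ a b _ → swap x (+ B a b) (x ^ a)))) (*-identityˡ _) ⟩
      conv i (λ a b → + B a b * x ^ suc a) + conv i (λ a b → + B a b * x ^ a)
    ≡⟨ pascal i (λ a b → x ^ a) ⟨
      conv (suc i) (λ a b → + B a b * x ^ a)
    ∎
    where
    swap : ∀ (x b y : ℤ) → x * (b * y) ≡ b * (x * y)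
    swap = solve-∀

  parity : ∀ i → (∃[ u ] i ≡ u ℕ.* 2) ⊎ (∃[ u ] i ≡ suc (u ℕ.* 2))
  parity zero = inj₁ (0 , refl)
  parity (suc i) with parity i
  ... | inj₁ (u , i≡2u) = inj₂ (u , cong suc i≡2u)
  ... | inj₂ (u , i≡2u+1) = inj₁ (suc u , cong suc i≡2u+1)

  even≢odd : ∀ a b → a ℕ.* 2 ≢ suc (b ℕ.* 2)
  even≢odd zero b ()
  even≢odd (suc zero) zero ()
  even≢odd (suc zero) (suc b) ()
  even≢odd (suc (suc a)) zero ()
  even≢odd (suc (suc a)) (suc b) e = even≢odd (suc a) b (ℕP.suc-injective (ℕP.suc-injective e))

  odd-complement : ∀ k i t → k ℕ.+ i ≡ t ℕ.* 2 → ∃[ u ] i ≡ suc (u ℕ.* 2) → ∃[ v ] k ≡ suc (v ℕ.* 2)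
  odd-complement k i t k+i≡2t (u , i≡2u+1) with parity k
  ... | inj₂ k-odd = k-odd
  ... | inj₁ (v , k≡2v) = ⊥-elim (even≢odd t (v ℕ.+ u) (sym (begin
          suc ((v ℕ.+ u) ℕ.* 2)     ≡⟨ regroup v u ⟨
          v ℕ.* 2 ℕ.+ suc (u ℕ.* 2) ≡⟨ cong₂ ℕ._+_ k≡2v i≡2u+1 ⟨
          k ℕ.+ i                    ≡⟨ k+i≡2t ⟩
          t ℕ.* 2                    ∎)))
    where
    regroup : ∀ v u → v ℕ.* 2 ℕ.+ suc (u ℕ.* 2) ≡ suc ((v ℕ.+ u) ℕ.* 2)
    regroup = ℕSolver.solve-∀

  sign-even : ∀ u → (- + 1) ^ (u ℕ.* 2) ≡ + 1
  sign-even zero = refl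
  sign-even (suc u) rewrite sign-even u = refl

  sign-odd : ∀ u → (- + 1) ^ suc (u ℕ.* 2) ≡ - + 1
  sign-odd u rewrite sign-even u = refl

  odd-indicator-even : ∀ u → (+ 1) ^ (u ℕ.* 2) - (- + 1) ^ (u ℕ.* 2) ≡ + 0
  odd-indicator-even u rewrite ^-zeroˡ (u ℕ.* 2) | sign-even u = refl

  odd-indicator-odd : ∀ u → (+ 1) ^ suc (u ℕ.* 2) - (- + 1) ^ suc (u ℕ.* 2) ≡ + 2
  odd-indicator-odd u rewrite ^-zeroˡ (suc (u ℕ.* 2)) | sign-odd u = refl

  atOne : ℕ → ℤ
  atOne 1 = + 1
  atOne _ = + 0

  conv-atOne : ∀ n (f : ℕ → ℕ → ℤ) → conv (suc n) (λ j r → f j r * atOne r) ≡ f n 1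
  conv-atOne n f =
    begin
      conv (suc n) (λ j r → f j r * atOne r)
    ≡⟨ conv-snoc n (λ j r → f j r * atOne r) ⟩
      conv n (λ j r → f j (suc r) * atOne (suc r)) + f (suc n) 0 * + 0
    ≡⟨ cong₂ _+_ (atOne-last n (λ j r → f j (suc r))) (*-zeroʳ (f (suc n) 0)) ⟩
      f n 1 + + 0
    ≡⟨ +-identityʳ (f n 1) ⟩
      f n 1
    ∎
    where
    atOne-last : ∀ n (g : ℕ → ℕ → ℤ) → conv n (λ j r → g j r * atOne (suc r)) ≡ g n 0
    atOne-last zero g = *-identityʳ (g 0 0)
    atOne-last (suc n) g =
      begin
        conv (suc n) (λ j r → g j r * atOne (suc r))
      ≡⟨ conv-snoc n (λ j r → g j r * atOne (suc r)) ⟩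
        conv n (λ j r → g j (suc r) * + 0) + g (suc n) 0 * + 1
      ≡⟨ cong₂ _+_ (trans (conv-cong n (λ j r _ → *-zeroʳ (g j (suc r)))) (conv-zero n)) (*-identityʳ (g (suc n) 0)) ⟩
        + 0 + g (suc n) 0
      ≡⟨ +-identityˡ (g (suc n) 0) ⟩
        g (suc n) 0
      ∎

  -- Suppose h satisfies the Genocchi-type recurrence
  --   h m + Σ_{k ≤ m} C(m,k) h k = c·[m = 1],
  -- i.e. (e^t + 1)·H(t) = c t for its exponential generating function H (Genocchi
  -- numbers: c = 2).  Then P_q(x) = Σ_{k+i=q} C(q,k) h_k x^i, whose generating
  -- function is H(t) e^{xt}, satisfies P_q(x + 1) + P_q(x) = const + c q x^{q-1}, and
  -- consequently P_q(x + 2) - P_q(x) = c q ((x + 1)^{q-1} - x^{q-1}).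
  module Appell (h : ℕ → ℤ) (c : ℤ) where

    binomSum : ℕ → ℤ
    binomSum m = conv m (λ k l → + B k l * h k)

    Recurrence : ℕ → Set
    Recurrence n = ∀ m → m ℕ.≤ n → h m + binomSum m ≡ c * atOne m

    P : ℕ → ℤ → ℤ
    P q x = conv q (λ k i → + B k i * h k * x ^ i)

    P-shift : ∀ q x → P q (x + + 1) ≡ conv q (λ j r → + B j r * x ^ j * binomSum r)
    P-shift q x =
      begin
        conv q (λ k i → + B k i * h k * (x + + 1) ^ i)
      ≡⟨ conv-cong q (λ k i _ → trans (cong (λ z → + B k i * h k * z) (binomial x i)) (sym (conv-*ˡ i (+ B k i * h k) _))) ⟩
        conv q (λ k i → conv i (λ j l → + B k i * h k * (+ B j l * x ^ j)))
      ≡⟨ conv-cong q (λ k i _ → conv-cong i (λ j l e → cong (λ z → + B k z * h k * (+ B j l * x ^ j)) (sym e))) ⟩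
        conv q (λ k r → conv r (λ j l → F k j l))
      ≡⟨ conv-assoc q F ⟩
        conv q (λ s l → conv s (λ k j → F k j l))
      ≡⟨ conv-cong q (λ s l _ → conv-comm s (λ k j → F k j l)) ⟩
        conv q (λ s l → conv s (λ j k → F k j l))
      ≡⟨ conv-assoc q (λ j k l → F k j l) ⟨
        conv q (λ j r → conv r (λ k l → F k j l))
      ≡⟨ conv-cong q (λ j r _ → conv-cong r (λ k l e → trinomial-term j r k l e)) ⟩
        conv q (λ j r → conv r (λ k l → + B j r * x ^ j * (+ B k l * h k)))
      ≡⟨ conv-cong q (λ j r _ → conv-*ˡ r (+ B j r * x ^ j) (λ k l → + B k l * h k)) ⟩
        conv q (λ j r → + B j r * x ^ j * binomSum r)
      ∎
      where
      F : ℕ → ℕ → ℕ → ℤ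
      F k j l = + B k (j ℕ.+ l) * h k * (+ B j l * x ^ j)
      trinomial-term : ∀ j r k l → k ℕ.+ l ≡ r → F k j l ≡ + B j r * x ^ j * (+ B k l * h k)
      trinomial-term j r k l refl =
        begin
          + B k (j ℕ.+ l) * h k * (+ B j l * x ^ j)
        ≡⟨ regroup₁ (+ B k (j ℕ.+ l)) (+ B j l) (h k) (x ^ j) ⟩
          + B k (j ℕ.+ l) * + B j l * x ^ j * h k
        ≡⟨ cong (λ z → z * x ^ j * h k) (trans (sym (pos-* (B k (j ℕ.+ l)) (B j l)))
                                           (trans (cong +_ (B-trinomial k j l)) (pos-* (B j (k ℕ.+ l)) (B k l)))) ⟩
          + B j (k ℕ.+ l) * + B k l * x ^ j * h k
        ≡⟨ regroup₂ (+ B j (k ℕ.+ l)) (+ B k l) (x ^ j) (h k) ⟩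
          + B j (k ℕ.+ l) * x ^ j * (+ B k l * h k)
        ∎
        where
        regroup₁ : ∀ (a b u v : ℤ) → a * u * (b * v) ≡ a * b * v * u
        regroup₁ = solve-∀
        regroup₂ : ∀ (a b v u : ℤ) → a * b * v * u ≡ a * v * (b * u)
        regroup₂ = solve-∀

    P-flip : ∀ q x → P q x ≡ conv q (λ j r → + B j r * x ^ j * h r)
    P-flip q x =
      trans (conv-comm q (λ k i → + B k i * h k * x ^ i))
            (conv-cong q (λ j r _ → trans (cong (λ z → + z * h r * x ^ j) (B-sym r j)) (swap (+ B j r) (h r) (x ^ j))))
      where
      swap : ∀ (a b u : ℤ) → a * b * u ≡ a * u * b
      swap = solve-∀

    appell : ∀ n → Recurrence (suc n) → ∀ x →
      P (suc (suc n)) (x + + 1) + P (suc (suc n)) x ≡ (binomSum (suc (suc n)) + h (suc (suc n))) + c * + suc (suc n) * x ^ suc n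
    appell n rec x =
      begin
        P q (x + + 1) + P q x
      ≡⟨ cong₂ _+_ (P-shift q x) (P-flip q x) ⟩
        conv q (λ j r → + B j r * x ^ j * binomSum r) + conv q (λ j r → + B j r * x ^ j * h r)
      ≡⟨ conv-+ q (λ j r → + B j r * x ^ j * binomSum r) (λ j r → + B j r * x ^ j * h r) ⟨
        conv q (λ j r → + B j r * x ^ j * binomSum r + + B j r * x ^ j * h r)
      ≡⟨ conv-cong q (λ j r _ → sym (*-distribˡ-+ (+ B j r * x ^ j) (binomSum r) (h r))) ⟩
        + 1 * (binomSum q + h q) + conv (suc n) (λ j r → + B (suc j) r * x ^ suc j * (binomSum r + h r))
      ≡⟨ cong₂ _+_ (*-identityˡ (binomSum q + h q)) (conv-cong (suc n) (λ j r e → cong (+ B (suc j) r * x ^ suc j *_) (recurrence-at j r e))) ⟩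
        (binomSum q + h q) + conv (suc n) (λ j r → + B (suc j) r * x ^ suc j * (c * atOne r))
      ≡⟨ cong (_+_ (binomSum q + h q)) (trans (conv-cong (suc n) (λ j r _ → sym (*-assoc (+ B (suc j) r * x ^ suc j) c (atOne r))))
                                               (conv-atOne n (λ j r → + B (suc j) r * x ^ suc j * c))) ⟩
        (binomSum q + h q) + + B (suc n) 1 * x ^ suc n * c
      ≡⟨ cong (λ z → (binomSum q + h q) + + z * x ^ suc n * c) (B-oneʳ (suc n)) ⟩
        (binomSum q + h q) + + q * x ^ suc n * c
      ≡⟨ cong (_+_ (binomSum q + h q)) (rotate (+ q) (x ^ suc n) c) ⟩
        (binomSum q + h q) + c * + q * x ^ suc n
      ∎
      where
      q : ℕ
      q = suc (suc n)
      recurrence-at : ∀ j r → j ℕ.+ r ≡ suc n → binomSum r + h r ≡ c * atOne r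
      recurrence-at j r e = trans (+-comm (binomSum r) (h r)) (rec r (subst (r ℕ.≤_) e (ℕP.m≤n+m r j)))
      rotate : ∀ (a b c : ℤ) → a * b * c ≡ c * a * b
      rotate = solve-∀

    appell-step : ∀ n → Recurrence (suc n) → ∀ x →
      P (suc (suc n)) ((x + + 1) + + 1) - P (suc (suc n)) x ≡ c * + suc (suc n) * ((x + + 1) ^ suc n - x ^ suc n)
    appell-step n rec x =
      difference (P q ((x + + 1) + + 1)) (P q (x + + 1)) (P q x) (binomSum q + h q) ((x + + 1) ^ suc n) (x ^ suc n)
                 (appell n rec (x + + 1)) (appell n rec x)
      where
      q : ℕ
      q = suc (suc n)
      difference : ∀ a b d K u v → a + b ≡ K + c * + q * u → b + d ≡ K + c * + q * v → a - d ≡ c * + q * (u - v)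
      difference a b d K u v e₁ e₂ =
        begin
          a - d
        ≡⟨ cancel-b a b d ⟩
          (a + b) - (b + d)
        ≡⟨ cong₂ _-_ e₁ e₂ ⟩
          (K + c * + q * u) - (K + c * + q * v)
        ≡⟨ cancel-K K (c * + q) u v ⟩
          c * + q * (u - v)
        ∎
        where
        cancel-b : ∀ a b d → a - d ≡ (a + b) - (b + d)
        cancel-b = solve-∀
        cancel-K : ∀ K k u v → (K + k * u) - (K + k * v) ≡ k * (u - v)
        cancel-K = solve-∀

    -- The part of P of degree ≥ 2 in x, divided by x²:  R_r(x) = Σ_{k+i=r} C(r+2,k) h_k x^i.
    R : ℕ → ℤ → ℤ
    R r x = conv r (λ k i → + B k (suc (suc i)) * h k * x ^ i)

    P-split : ∀ r x → P (suc (suc r)) x ≡ x * x * R r x + + suc (suc r) * h (suc r) * x + h (suc (suc r))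
    P-split r x =
      begin
        P (suc (suc r)) x
      ≡⟨ conv-snoc (suc r) (λ k i → + B k i * h k * x ^ i) ⟩
        conv (suc r) (λ k i → + B k (suc i) * h k * x ^ suc i) + + B (suc (suc r)) 0 * h (suc (suc r)) * + 1
      ≡⟨ cong₂ _+_ (conv-snoc r (λ k i → + B k (suc i) * h k * x ^ suc i)) constant-term ⟩
        conv r (λ k i → + B k (suc (suc i)) * h k * x ^ suc (suc i)) + + B (suc r) 1 * h (suc r) * (x * + 1) + h (suc (suc r))
      ≡⟨ cong₂ (λ u v → u + v + h (suc (suc r))) quadratic-part linear-term ⟩
        x * x * R r x + + suc (suc r) * h (suc r) * x + h (suc (suc r))
      ∎
      where
      constant-term : + B (suc (suc r)) 0 * h (suc (suc r)) * + 1 ≡ h (suc (suc r))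
      constant-term = trans (*-identityʳ _) (*-identityˡ _)
      linear-term : + B (suc r) 1 * h (suc r) * (x * + 1) ≡ + suc (suc r) * h (suc r) * x
      linear-term rewrite B-oneʳ (suc r) = cong (+ suc (suc r) * h (suc r) *_) (*-identityʳ x)
      quadratic-part : conv r (λ k i → + B k (suc (suc i)) * h k * x ^ suc (suc i)) ≡ x * x * R r x
      quadratic-part = trans (conv-cong r (λ k i _ → factor (+ B k (suc (suc i)) * h k) x (x ^ i)))
                             (conv-*ˡ r (x * x) (λ k i → + B k (suc (suc i)) * h k * x ^ i))
        where
        factor : ∀ a x y → a * (x * (x * y)) ≡ x * x * (a * y)
        factor = solve-∀

    binomSum-∑ : ∀ m → binomSum m ≡ ∑ m (λ k → + (m C k) * h k) + h m
    binomSum-∑ m =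
      begin
        conv m (λ k l → + B k l * h k)
      ≡⟨ conv-as-∑ m (λ k l → + B k l * h k) ⟩
        ∑ m (λ k → + B k (m ℕ.∸ k) * h k) + + B m (m ℕ.∸ m) * h m
      ≡⟨ cong₂ _+_ (∑-cong m lower-term) top-term ⟩
        ∑ m (λ k → + (m C k) * h k) + h m
      ∎
      where
      lower-term : ∀ k → k ℕ.< m → + B k (m ℕ.∸ k) * h k ≡ + (m C k) * h k
      lower-term k k<m = cong (λ z → + z * h k) (trans (sym (B-C k (m ℕ.∸ k))) (cong (_C k) (ℕP.m+[n∸m]≡n (ℕP.<⇒≤ k<m))))
      top-term : + B m (m ℕ.∸ m) * h m ≡ h m
      top-term rewrite ℕP.n∸n≡0 m | B-zeroʳ m = *-identityˡ (h m)

    P-sub-constant : ∀ r x → P (suc (suc r)) x - P (suc (suc r)) (+ 0) ≡ x * x * R r x + + suc (suc r) * h (suc r) * x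
    P-sub-constant r x =
      trans (cong₂ _-_ (P-split r x) (P-split r (+ 0)))
            (cancel x (R r x) (R r (+ 0)) (+ suc (suc r) * h (suc r)) (h (suc (suc r))))
      where
      cancel : ∀ x R R₀ a c → (x * x * R + a * x + c) - (+ 0 * + 0 * R₀ + a * + 0 + c) ≡ x * x * R + a * x
      cancel = solve-∀

    P-odd-part : ∀ r → P (suc (suc r)) (+ 1) - P (suc (suc r)) (- + 1) ≡ R r (+ 1) - R r (- + 1) + + suc (suc r) * h (suc r) * + 2
    P-odd-part r =
      trans (cong₂ _-_ (P-split r (+ 1)) (P-split r (- + 1)))
            (collect (R r (+ 1)) (R r (- + 1)) (+ suc (suc r) * h (suc r)) (h (suc (suc r))))
      where
      collect : ∀ R₊ R₋ a c → (+ 1 * + 1 * R₊ + a * + 1 + c) - (- + 1 * - + 1 * R₋ + a * - + 1 + c) ≡ R₊ - R₋ + a * + 2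
      collect = solve-∀

    -- If h vanishes at the odd indices 3, 5, …, 2j + 1, then in R_{2j+2}(1) - R_{2j+2}(-1)
    -- only the term k = 1 survives: even powers of ±1 cancel, and odd powers of x
    -- in R_{2j+2} come with odd k.
    R-odd-part : ∀ j → (∀ v → suc (v ℕ.* 2) ℕ.≤ j ℕ.* 2 → h (suc (suc (suc (v ℕ.* 2)))) ≡ + 0) →
      R (suc (suc (j ℕ.* 2))) (+ 1) - R (suc (suc (j ℕ.* 2))) (- + 1) ≡ + suc (suc (suc (suc (j ℕ.* 2)))) * h 1 * + 2
    R-odd-part j vanish =
      begin
        R (suc (suc m)) (+ 1) - R (suc (suc m)) (- + 1)
      ≡⟨ conv-- (suc (suc m)) (λ k i → + B k (suc (suc i)) * h k * (+ 1) ^ i) (λ k i → + B k (suc (suc i)) * h k * (- + 1) ^ i) ⟨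
        conv (suc (suc m)) (λ k i → + B k (suc (suc i)) * h k * (+ 1) ^ i - + B k (suc (suc i)) * h k * (- + 1) ^ i)
      ≡⟨ conv-cong (suc (suc m)) (λ k i _ → factor (+ B k (suc (suc i)) * h k) ((+ 1) ^ i) ((- + 1) ^ i)) ⟩
        T 0 (suc (suc m)) + (T 1 (suc m) + conv m (λ k i → T (suc (suc k)) i))
      ≡⟨ cong₂ (λ u v → u + (T 1 (suc m) + v)) first-term (trans (conv-cong m middle-term) (conv-zero m)) ⟩
        + 0 + (T 1 (suc m) + + 0)
      ≡⟨ trans (+-identityˡ _) (+-identityʳ _) ⟩
        T 1 (suc m)
      ≡⟨ cong₂ (λ u v → + u * h 1 * v) (trans (B-sym 1 (suc (suc (suc m)))) (B-oneʳ (suc (suc (suc m))))) (odd-indicator-odd j) ⟩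
        + suc (suc (suc (suc m))) * h 1 * + 2
      ∎
      where
      m : ℕ
      m = j ℕ.* 2
      T : ℕ → ℕ → ℤ
      T k i = + B k (suc (suc i)) * h k * ((+ 1) ^ i - (- + 1) ^ i)
      factor : ∀ a u v → a * u - a * v ≡ a * (u - v)
      factor = solve-∀
      first-term : T 0 (suc (suc m)) ≡ + 0
      first-term = trans (cong (+ B 0 (suc (suc (suc (suc m)))) * h 0 *_) (odd-indicator-even (suc j))) (*-zeroʳ (+ B 0 (suc (suc (suc (suc m)))) * h 0))
      middle-term : ∀ k i → k ℕ.+ i ≡ m → T (suc (suc k)) i ≡ + 0
      middle-term k i k+i≡m with parity i
      ... | inj₁ (u , refl) = trans (cong (+ B (suc (suc k)) (suc (suc (u ℕ.* 2))) * h (suc (suc k)) *_) (odd-indicator-even u)) (*-zeroʳ (+ B (suc (suc k)) (suc (suc (u ℕ.* 2))) * h (suc (suc k))))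
      ... | inj₂ i-odd with odd-complement k i j k+i≡m i-odd
      ...   | (v , refl) = trans (cong (λ z → + B (suc (suc k)) (suc (suc i)) * z * ((+ 1) ^ i - (- + 1) ^ i)) (vanish v k≤m))
                                 (cong (_* ((+ 1) ^ i - (- + 1) ^ i)) (*-zeroʳ (+ B (suc (suc k)) (suc (suc i)))))
        where
        k≤m : suc (v ℕ.* 2) ℕ.≤ m
        k≤m = subst (suc (v ℕ.* 2) ℕ.≤_) k+i≡m (ℕP.m≤m+n (suc (v ℕ.* 2)) i)

  G : ℕ → ℤ
  G = genocchi

  lowerSum : ℕ → ℤ
  lowerSum n = ∑ n (λ k → + (n C k) * G k)

  numerator : ℕ → ℤ
  numerator n = δ₁ n - lowerSum n

  genocchi-unfold : ∀ n → G n ≡ numerator n ℤ./ + 2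
  genocchi-unfold n = cong (λ z → (δ₁ n - z) ℤ./ + 2) (fold-as-∑ n n)
    where
    fold-as-∑ : ∀ k N → foldr _+_ (+ 0) (zipWith (λ i g → + (N C i) * g) (downFrom k) (revG k)) ≡ ∑ k (λ i → + (N C i) * G i)
    fold-as-∑ zero N = refl
    fold-as-∑ (suc k) N rewrite fold-as-∑ k N = +-comm (+ (N C k) * G k) (∑ k (λ i → + (N C i) * G i))

  half-of-double : ∀ y → (y * + 2) ℤ./ + 2 ≡ y
  half-of-double y with (y * + 2) ℤ.% + 2 | n%d<d (y * + 2) (+ 2) | a≡a%n+[a/n]*n (y * + 2) (+ 2)
  ... | zero | _ | y2≡q2 = sym (*-cancelʳ-≡ y ((y * + 2) ℤ./ + 2) (+ 2) (trans y2≡q2 (+-identityˡ _)))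
  ... | suc zero | _ | y2≡1+q2 = ⊥-elim (2∤1 (ℕD.∣⇒≤ (D.∣⇒∣ᵤ (D.divides (y - (y * + 2) ℤ./ + 2) (odd-remainder y _ y2≡1+q2)))))
    where
    2∤1 : ¬ (2 ℕ.≤ 1)
    2∤1 (ℕ.s≤s ())
    odd-remainder : ∀ y q → y * + 2 ≡ + 1 + q * + 2 → + 1 ≡ (y - q) * + 2
    odd-remainder y q e = trans (isolate q) (trans (cong (_- q * + 2) (sym e)) (distrib y q))
      where
      isolate : ∀ q → + 1 ≡ + 1 + q * + 2 - q * + 2
      isolate = solve-∀
      distrib : ∀ y q → y * + 2 - q * + 2 ≡ (y - q) * + 2
      distrib = solve-∀
  ... | suc (suc r) | ℕ.s≤s (ℕ.s≤s ()) | _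

  GenocchiRec : ℕ → Set
  GenocchiRec n = + 2 * G n + lowerSum n ≡ δ₁ n

  halve : ∀ n y → numerator n ≡ y * + 2 → G n ≡ y × GenocchiRec n
  halve n y numerator≡2y = G≡y , (begin
      + 2 * G n + lowerSum n ≡⟨ cong (λ z → + 2 * z + lowerSum n) G≡y ⟩
      + 2 * y + lowerSum n   ≡⟨ cong (_+ lowerSum n) (*-comm (+ 2) y) ⟩
      y * + 2 + lowerSum n   ≡⟨ cong (_+ lowerSum n) numerator≡2y ⟨
      numerator n + lowerSum n ≡⟨ minus-plus (δ₁ n) (lowerSum n) ⟩
      δ₁ n                   ∎)
    where
    G≡y : G n ≡ y
    G≡y = trans (genocchi-unfold n) (trans (cong (ℤ._/ + 2) numerator≡2y) (half-of-double y))
    minus-plus : ∀ d s → d - s + s ≡ d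
    minus-plus = solve-∀

  numerator-double : ∀ {n} → GenocchiRec n → numerator n ≡ + 2 * G n
  numerator-double {n} rec = trans (cong (_- lowerSum n) (sym rec)) (plus-minus (+ 2 * G n) (lowerSum n))
    where
    plus-minus : ∀ a s → a + s - s ≡ a
    plus-minus = solve-∀

  δ₁-atOne : ∀ m → δ₁ m ≡ + 2 * atOne m
  δ₁-atOne zero = refl
  δ₁-atOne (suc zero) = refl
  δ₁-atOne (suc (suc m)) = refl

  OddVanishing : ℕ → Set
  OddVanishing n = ∀ t → n ≡ suc (suc (suc (t ℕ.* 2))) → G n ≡ + 0

  Good : ℕ → Set
  Good n = GenocchiRec n × OddVanishing n

  -- Under the induction hypothesis below n = n₁ + 2, the numerators w_m (m ≤ n) satisfy
  -- the Genocchi-type recurrence with constant 4 (since w_k = 2 G_k for k < n), so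
  -- their Appell polynomials obey P(x + 2) - P(x) = 4 q ((x + 1)^n - x^n), q = n + 1.
  module InductiveStep (n₁ : ℕ) (IH : ∀ {m} → m ℕ.< suc (suc n₁) → Good m) where

    open Appell numerator (+ 4) public

    numerator-below : ∀ k → k ℕ.< suc (suc n₁) → numerator k ≡ + 2 * G k
    numerator-below k k<n = numerator-double (proj₁ (IH k<n))

    numerator-recurrence : Recurrence (suc (suc n₁))
    numerator-recurrence m m≤n =
      begin
        numerator m + binomSum m
      ≡⟨ cong (_+_ (numerator m)) (binomSum-∑ m) ⟩
        numerator m + (∑ m (λ k → + (m C k) * numerator k) + numerator m)
      ≡⟨ cong (λ z → numerator m + (z + numerator m)) lower-doubles ⟩
        (δ₁ m - lowerSum m) + (+ 2 * lowerSum m + (δ₁ m - lowerSum m))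
      ≡⟨ collect (δ₁ m) (lowerSum m) ⟩
        + 2 * δ₁ m
      ≡⟨ cong (+ 2 *_) (δ₁-atOne m) ⟩
        + 2 * (+ 2 * atOne m)
      ≡⟨ *-assoc (+ 2) (+ 2) (atOne m) ⟨
        + 4 * atOne m
      ∎
      where
      lower-doubles : ∑ m (λ k → + (m C k) * numerator k) ≡ + 2 * lowerSum m
      lower-doubles =
        trans (∑-cong m (λ k k<m → trans (cong (+ (m C k) *_) (numerator-below k (ℕP.<-≤-trans k<m m≤n)))
                                         (*-comm-middle (+ (m C k)) (G k))))
              (∑-*ˡ m (+ 2) (λ k → + (m C k) * G k))
        where
        *-comm-middle : ∀ a g → a * (+ 2 * g) ≡ + 2 * (a * g)
        *-comm-middle = solve-∀
      collect : ∀ d s → (d - s) + (+ 2 * s + (d - s)) ≡ + 2 * d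
      collect = solve-∀

    step : ∀ x → P (suc (suc (suc n₁))) ((x + + 1) + + 1) - P (suc (suc (suc n₁))) x
                   ≡ + 4 * + suc (suc (suc n₁)) * ((x + + 1) ^ suc (suc n₁) - x ^ suc (suc n₁))
    step = appell-step (suc n₁) numerator-recurrence

  even-from-odd-factor : ∀ Y w J → + 2 * + 2 * (+ 2 * Y) + (+ 1 + + 2 * J) * w * + 2 ≡ + 4 * (+ 1 + + 2 * J) →
                         w ≡ ((+ 1 + + 2 * J) - + 2 * Y - J * w) * + 2
  even-from-odd-factor Y w J e =
    begin
      w
    ≡⟨ isolate Y w J ⟩
      (+ 4 * Y + (+ 1 + + 2 * J) * w) - + 4 * Y - + 2 * J * w
    ≡⟨ cong (λ z → z - + 4 * Y - + 2 * J * w) halved ⟩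
      + 2 * (+ 1 + + 2 * J) - + 4 * Y - + 2 * J * w
    ≡⟨ regroup Y w J ⟩
      ((+ 1 + + 2 * J) - + 2 * Y - J * w) * + 2
    ∎
    where
    halved : + 4 * Y + (+ 1 + + 2 * J) * w ≡ + 2 * (+ 1 + + 2 * J)
    halved = *-cancelˡ-≡ (+ 2) _ _ (trans (double-lhs Y w J) (trans e (double-rhs J)))
      where
      double-lhs : ∀ Y w J → + 2 * (+ 4 * Y + (+ 1 + + 2 * J) * w) ≡ + 2 * + 2 * (+ 2 * Y) + (+ 1 + + 2 * J) * w * + 2
      double-lhs = solve-∀
      double-rhs : ∀ J → + 4 * (+ 1 + + 2 * J) ≡ + 2 * (+ 2 * (+ 1 + + 2 * J))
      double-rhs = solve-∀
    isolate : ∀ Y w J → w ≡ (+ 4 * Y + (+ 1 + + 2 * J) * w) - + 4 * Y - + 2 * J * w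
    isolate = solve-∀
    regroup : ∀ Y w J → + 2 * (+ 1 + + 2 * J) - + 4 * Y - + 2 * J * w ≡ ((+ 1 + + 2 * J) - + 2 * Y - J * w) * + 2
    regroup = solve-∀

  -- Even n = 2j + 2: comparing P(2) - P(0) from the step identity with the expansion
  -- of P gives 8Y + 2 q w_n = 4 q with q = n + 1 odd, so w_n is even.
  even-step : ∀ j → (∀ {m} → m ℕ.< suc (suc (j ℕ.* 2)) → Good m) → Good (suc (suc (j ℕ.* 2)))
  even-step j IH = proj₂ (halve n ((+ 1 + + 2 * + suc j) - + 2 * Y - + suc j * numerator n) (even-from-odd-factor Y (numerator n) (+ suc j) evaluation)) , not-odd
    where
    open InductiveStep (j ℕ.* 2) IH
    n : ℕ
    n = suc (suc (j ℕ.* 2))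
    r : ℕ
    r = suc (j ℕ.* 2)
    -- R_r(2) = 2 Y since the coefficients w_k (k ≤ r) are doubled Genocchi numbers.
    Y : ℤ
    Y = conv r (λ k i → + B k (suc (suc i)) * G k * (+ 2) ^ i)
    halved-R : R r (+ 2) ≡ + 2 * Y
    halved-R = trans (conv-cong r (λ k i k+i≡r → cong (λ z → + B k (suc (suc i)) * z * (+ 2) ^ i)
                                                  (numerator-below k (ℕ.s≤s (subst (k ℕ.≤_) k+i≡r (ℕP.m≤m+n k i))))))
               (trans (conv-cong r (λ k i _ → pull-2 (+ B k (suc (suc i))) (G k) ((+ 2) ^ i)))
                      (conv-*ˡ r (+ 2) (λ k i → + B k (suc (suc i)) * G k * (+ 2) ^ i)))
      where
      pull-2 : ∀ b g y → b * (+ 2 * g) * y ≡ + 2 * (b * g * y)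
      pull-2 = solve-∀
    q≡1+2J : + suc n ≡ + 1 + + 2 * + suc j
    q≡1+2J = cong +_ (arith j)
      where
      arith : ∀ j → suc (suc (suc (j ℕ.* 2))) ≡ 1 ℕ.+ 2 ℕ.* suc j
      arith = ℕSolver.solve-∀
    evaluation : + 2 * + 2 * (+ 2 * Y) + (+ 1 + + 2 * + suc j) * numerator n * + 2 ≡ + 4 * (+ 1 + + 2 * + suc j)
    evaluation = begin
        + 2 * + 2 * (+ 2 * Y) + (+ 1 + + 2 * + suc j) * numerator n * + 2
      ≡⟨ cong₂ (λ u v → + 2 * + 2 * u + v * numerator n * + 2) halved-R q≡1+2J ⟨
        + 2 * + 2 * R r (+ 2) + + suc n * numerator n * + 2
      ≡⟨ P-sub-constant r (+ 2) ⟨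
        P (suc n) (+ 2) - P (suc n) (+ 0)
      ≡⟨ step (+ 0) ⟩
        + 4 * + suc n * ((+ 1) ^ n - + 0)
      ≡⟨ cong₂ (λ u v → + 4 * u * (v - + 0)) q≡1+2J (^-zeroˡ n) ⟩
        + 4 * (+ 1 + + 2 * + suc j) * + 1
      ≡⟨ *-identityʳ _ ⟩
        + 4 * (+ 1 + + 2 * + suc j)
      ∎
    not-odd : OddVanishing n
    not-odd t n≡2t+3 = ⊥-elim (even≢odd j t (ℕP.suc-injective (ℕP.suc-injective n≡2t+3)))

  zero-from-balance : ∀ Q w → Q * + 2 * + 2 + Q * w * + 2 ≡ + 4 * Q → + 2 * Q * w ≡ + 2 * Q * + 0
  zero-from-balance Q w e =
    begin
      + 2 * Q * w                             ≡⟨ isolate Q w ⟩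
      (Q * + 2 * + 2 + Q * w * + 2) - + 4 * Q ≡⟨ cong (_- + 4 * Q) e ⟩
      + 4 * Q - + 4 * Q                       ≡⟨ cancel Q ⟩
      + 2 * Q * + 0                           ∎
    where
    isolate : ∀ Q w → + 2 * Q * w ≡ (Q * + 2 * + 2 + Q * w * + 2) - + 4 * Q
    isolate = solve-∀
    cancel : ∀ Q → + 4 * Q - + 4 * Q ≡ + 2 * Q * + 0
    cancel = solve-∀

  -- Odd n = 2j + 3: P(1) - P(-1) = 4 q by the step identity, while the expansion of P,
  -- with G vanishing at the smaller odd indices ≥ 3, gives 4 q + 2 q w_n; so w_n = 0.
  odd-step : ∀ j → (∀ {m} → m ℕ.< suc (suc (suc (j ℕ.* 2))) → Good m) → Good (suc (suc (suc (j ℕ.* 2))))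
  odd-step j IH = proj₂ (halve n (+ 0) w≡0) , λ _ _ → proj₁ (halve n (+ 0) w≡0)
    where
    open InductiveStep (suc (j ℕ.* 2)) IH
    n : ℕ
    n = suc (suc (suc (j ℕ.* 2)))
    r : ℕ
    r = suc (suc (j ℕ.* 2))
    q : ℕ
    q = suc n
    smaller-odd-vanish : ∀ v → suc (v ℕ.* 2) ℕ.≤ j ℕ.* 2 → numerator (suc (suc (suc (v ℕ.* 2)))) ≡ + 0
    smaller-odd-vanish v bound = trans (numerator-below _ smaller) (cong (+ 2 *_) (proj₂ (IH smaller) v refl))
      where
      smaller : suc (suc (suc (v ℕ.* 2))) ℕ.< n
      smaller = ℕ.s≤s (ℕ.s≤s (ℕ.s≤s bound))
    evaluation : + q * + 2 * + 2 + + q * numerator n * + 2 ≡ + 4 * + q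
    evaluation = begin
        + q * + 2 * + 2 + + q * numerator n * + 2
      ≡⟨ cong (_+ + q * numerator n * + 2) (R-odd-part j smaller-odd-vanish) ⟨
        R r (+ 1) - R r (- + 1) + + q * numerator n * + 2
      ≡⟨ P-odd-part r ⟨
        P q (+ 1) - P q (- + 1)
      ≡⟨ step (- + 1) ⟩
        + 4 * + q * (+ 0 - (- + 1) ^ n)
      ≡⟨ cong (λ z → + 4 * + q * (+ 0 - z)) (sign-odd (suc j)) ⟩
        + 4 * + q * + 1
      ≡⟨ *-identityʳ (+ 4 * + q) ⟩
        + 4 * + q
      ∎
    w≡0 : numerator n ≡ + 0
    w≡0 = *-cancelˡ-≡ (+ 2 * + q) (numerator n) (+ 0) (zero-from-balance (+ q) (numerator n) evaluation)

  genocchi-good : ∀ n → Good n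
  genocchi-good = <-rec Good good-step
    where
    good-step : ∀ n → (∀ {m} → m ℕ.< n → Good m) → Good n
    good-step zero _ = refl , λ _ ()
    good-step (suc zero) _ = refl , λ _ ()
    good-step (suc (suc n₁)) IH with parity n₁
    ... | inj₁ (j , refl) = even-step j IH
    ... | inj₂ (j , refl) = odd-step j IH

  genocchi-recurrence : ∀ n → Appell.Recurrence G (+ 2) n
  genocchi-recurrence n m _ =
    begin
      G m + binomSum m               ≡⟨ cong (_+_ (G m)) (binomSum-∑ m) ⟩
      G m + (lowerSum m + G m)       ≡⟨ regroup (G m) (lowerSum m) ⟩
      + 2 * G m + lowerSum m         ≡⟨ proj₁ (genocchi-good m) ⟩
      δ₁ m                           ≡⟨ δ₁-atOne m ⟩
      + 2 * atOne m                  ∎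
    where
    open Appell G (+ 2)
    regroup : ∀ g s → g + (s + g) ≡ + 2 * g + s
    regroup = solve-∀

  prime-divides-product : ∀ {p} → Prime p → ∀ a b → + p ∣ a * b → + p ∣ a ⊎ + p ∣ b
  prime-divides-product {p} pp a b p∣ab with euclidsLemma ℤ.∣ a ∣ ℤ.∣ b ∣ pp (subst (p ℕD.∣_) (abs-* a b) (D.∣⇒∣ᵤ p∣ab))
  ... | inj₁ p∣a = inj₁ (D.∣ᵤ⇒∣ p∣a)
  ... | inj₂ p∣b = inj₂ (D.∣ᵤ⇒∣ p∣b)

  prime∤smaller : ∀ {p} k → suc k ℕ.< p → ¬ (+ p ∣ + suc k)
  prime∤smaller k k<p p∣k = ℕP.<⇒≱ k<p (ℕD.∣⇒≤ (D.∣⇒∣ᵤ p∣k))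

  prime-cancelˡ : ∀ {p} → Prime p → ∀ a b → ¬ (+ p ∣ a) → + p ∣ a * b → + p ∣ b
  prime-cancelˡ pp a b p∤a p∣ab with prime-divides-product pp a b p∣ab
  ... | inj₁ p∣a = ⊥-elim (p∤a p∣a)
  ... | inj₂ p∣b = p∣b

  prime∤∏ : ∀ {p} → Prime p → ∀ n (f : ℕ → ℤ) → (∀ i → i ℕ.< n → ¬ (+ p ∣ f i)) → ¬ (+ p ∣ ∏ n f)
  prime∤∏ {p} pp zero f _ = prime∤smaller 0 (ℕ.nonTrivial⇒n>1 p {{prime⇒nonTrivial pp}})
  prime∤∏ pp (suc n) f p∤f p∣∏ with prime-divides-product pp (∏ n f) (f n) p∣∏
  ... | inj₁ p∣∏n = prime∤∏ pp n f (λ i i<n → p∤f i (ℕP.m<n⇒m<1+n i<n)) p∣∏n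
  ... | inj₂ p∣fn = p∤f n ℕP.≤-refl p∣fn

  powerSum : ℕ → ℕ → ℤ
  powerSum p a = ∑ p (λ i → (+ i) ^ a)

  power-difference : ∀ k (x : ℤ) → (x + + 1) ^ suc k - x ^ suc k ≡ conv k (λ a b → + B a (suc b) * x ^ a)
  power-difference k x =
    begin
      (x + + 1) ^ suc k - x ^ suc k
    ≡⟨ cong (_- x ^ suc k) (trans (binomial x (suc k)) (conv-snoc k (λ a b → + B a b * x ^ a))) ⟩
      (conv k (λ a b → + B a (suc b) * x ^ a) + + B (suc k) 0 * x ^ suc k) - x ^ suc k
    ≡⟨ cancel (conv k (λ a b → + B a (suc b) * x ^ a)) (x ^ suc k) ⟩
      conv k (λ a b → + B a (suc b) * x ^ a)
    ∎
    where
    cancel : ∀ c y → c + + 1 * y - y ≡ c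
    cancel = solve-∀

  -- Summing power-difference over x = 0, …, p - 1 telescopes:
  -- p^{k+1} = Σ_{a+b=k} C(k+1,a) S_p(a).
  power-identity : ∀ p k → (+ p) ^ suc k ≡ conv k (λ a b → + B a (suc b) * powerSum p a)
  power-identity p k =
    begin
      (+ p) ^ suc k
    ≡⟨ +-identityʳ _ ⟨
      (+ p) ^ suc k - (+ 0) ^ suc k
    ≡⟨ ∑-telescope p (λ i → (+ i) ^ suc k) ⟨
      ∑ p (λ i → (+ suc i) ^ suc k - (+ i) ^ suc k)
    ≡⟨ ∑-cong p (λ i _ → trans (cong (λ z → (+ z) ^ suc k - (+ i) ^ suc k) (ℕP.+-comm 1 i)) (power-difference k (+ i))) ⟩
      ∑ p (λ i → conv k (λ a b → + B a (suc b) * (+ i) ^ a))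
    ≡⟨ ∑-conv p k (λ i a b → + B a (suc b) * (+ i) ^ a) ⟩
      conv k (λ a b → ∑ p (λ i → + B a (suc b) * (+ i) ^ a))
    ≡⟨ conv-cong k (λ a b _ → ∑-*ˡ p (+ B a (suc b)) (λ i → (+ i) ^ a)) ⟩
      conv k (λ a b → + B a (suc b) * powerSum p a)
    ∎

  -- p ∣ S_p(a) for 1 ≤ a ≤ p - 2, by strong induction on a: in the power identity for
  -- k = a + 1 every term but (a + 2) S_p(a + 1) is divisible by p (S_p(0) = p).
  powerSum-divisible : ∀ {p} → Prime p → ∀ a → suc (suc a) ℕ.< p → + p ∣ powerSum p (suc a)
  powerSum-divisible {p} pp = <-rec (λ a → suc (suc a) ℕ.< p → + p ∣ powerSum p (suc a)) divisible-step
    where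
    divisible-step : ∀ a → (∀ {b} → b ℕ.< a → suc (suc b) ℕ.< p → + p ∣ powerSum p (suc b)) →
                     suc (suc a) ℕ.< p → + p ∣ powerSum p (suc a)
    divisible-step a IH a+2<p = prime-cancelˡ pp (+ suc (suc a)) (powerSum p (suc a)) (prime∤smaller (suc a) a+2<p) (D.∣m+n∣m⇒∣n p∣total p∣lower)
      where
      lower : ℤ
      lower = conv a (λ b c → + B b (suc (suc c)) * powerSum p b)
      identity : (+ p) ^ suc (suc a) ≡ lower + + suc (suc a) * powerSum p (suc a)
      identity = trans (power-identity p (suc a))
                       (trans (conv-snoc a (λ b c → + B b (suc c) * powerSum p b))
                              (cong (λ z → lower + + z * powerSum p (suc a)) (B-oneʳ (suc a))))
      p∣total : + p ∣ lower + + suc (suc a) * powerSum p (suc a)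
      p∣total = subst (+ p ∣_) identity (D.∣m⇒∣m*n ((+ p) ^ suc a) D.∣-refl)
      p∣lower : + p ∣ lower
      p∣lower = conv-∣ a term
        where
        term : ∀ b c → b ℕ.+ c ≡ a → + p ∣ + B b (suc (suc c)) * powerSum p b
        term zero c _ = D.∣n⇒∣m*n (+ B 0 (suc (suc c))) (subst (+ p ∣_) (sym (∑-ones p)) D.∣-refl)
        term (suc b) c b+c≡a = D.∣n⇒∣m*n (+ B (suc b) (suc (suc c))) (IH b<a (ℕP.<-trans (ℕ.s≤s (ℕ.s≤s b<a)) a+2<p))
          where
          b<a : b ℕ.< a
          b<a = subst (suc b ℕ.≤_) b+c≡a (ℕP.m≤m+n (suc b) c)

  -- Gauss's lemma for the residue 2: if p = 8t + 1 then 2^{(p-1)/2} ≡ 1 (mod p).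
  -- With H = 2t and N = 2H = (p-1)/2, doubling every factor of N! gives
  --   2^N N! = ∏_{i<H} 2(i+1) · ∏_{i<H} 2(H+i+1),
  -- where the second product runs over p - (2i+1) ≡ -(2i+1) for i < H, an even number of
  -- factors; so 2^N N! ≡ ∏_{i<H} 2(i+1) · ∏_{i<H} (2i+1) = N! (mod p), and p ∤ N!.
  module GaussLemma (t p : ℕ) (pp : Prime p) (p≡8t+1 : p ≡ suc (t ℕ.* 8)) where

    H : ℕ
    H = t ℕ.* 2
    N : ℕ
    N = H ℕ.* 2
    N≡4t : ∀ t → t ℕ.* 2 ℕ.* 2 ≡ t ℕ.* 4
    N≡4t = ℕSolver.solve-∀
    even odd : ℕ → ℤ
    even i = + 2 * + suc i
    odd i = + 2 * + i + + 1
    factorial : ℤ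
    factorial = ∏ N (λ i → + suc i)
    evens : ℤ
    evens = ∏ H even
    doubled : (+ 2) ^ N * factorial ≡ evens * ∏ H (λ i → even (H ℕ.+ i))
    doubled = trans (sym (∏-*ˡ N (+ 2) (λ i → + suc i))) (trans (cong (λ z → ∏ z even) (halves t)) (∏-split H H even))
      where
      halves : ∀ t → t ℕ.* 2 ℕ.* 2 ≡ t ℕ.* 2 ℕ.+ t ℕ.* 2
      halves = ℕSolver.solve-∀
    factorial-split : factorial ≡ ∏ H odd * evens
    factorial-split = trans (∏-pairs H (λ i → + suc i)) (trans (∏-cong H (λ i _ → cong₂ _*_ (odd-factor i) (even-factor i))) (∏-* H odd even))
      where
      odd-factor : ∀ i → + suc (i ℕ.* 2) ≡ odd i
      odd-factor i = trans (cong +_ (ℕP.+-comm 1 (i ℕ.* 2))) (trans (pos-+ (i ℕ.* 2) 1) (cong (_+ + 1) (trans (pos-* i 2) (*-comm (+ i) (+ 2)))))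
      even-factor : ∀ i → + suc (suc (i ℕ.* 2)) ≡ even i
      even-factor i = trans (cong +_ (ℕP.*-comm (suc i) 2)) (pos-* 2 (suc i))
    upper-reflect : ∀ i → i ℕ.< H → even (H ℕ.+ (H ℕ.∸ suc i)) ≡ + p - odd i
    upper-reflect i i<H = solve-difference (even (H ℕ.+ j)) (odd i) (+ p)
      (trans (trans (cong₂ _+_ (sym (pos-* 2 (suc (H ℕ.+ j)))) (cong (_+ + 1) (sym (pos-* 2 i)))) (sym (pos-+ (2 ℕ.* suc (H ℕ.+ j)) (2 ℕ.* i ℕ.+ 1))))
             (cong +_ sum-is-p))
      where
      j : ℕ
      j = H ℕ.∸ suc i
      solve-difference : ∀ x y z → x + y ≡ z → x ≡ z - y
      solve-difference x y z e = trans (add-sub x y) (cong (_- y) e)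
        where
        add-sub : ∀ x y → x ≡ x + y - y
        add-sub = solve-∀
      regroup : ∀ t i j → 2 ℕ.* suc (t ℕ.* 2 ℕ.+ j) ℕ.+ (2 ℕ.* i ℕ.+ 1) ≡ suc (2 ℕ.* (suc i ℕ.+ j) ℕ.+ t ℕ.* 4)
      regroup = ℕSolver.solve-∀
      eight : ∀ t → suc (2 ℕ.* (t ℕ.* 2) ℕ.+ t ℕ.* 4) ≡ suc (t ℕ.* 8)
      eight = ℕSolver.solve-∀
      sum-is-p : 2 ℕ.* suc (H ℕ.+ j) ℕ.+ (2 ℕ.* i ℕ.+ 1) ≡ p
      sum-is-p = trans (regroup t i j) (trans (cong (λ z → suc (2 ℕ.* z ℕ.+ t ℕ.* 4)) (ℕP.m+[n∸m]≡n i<H)) (trans (eight t) (sym p≡8t+1)))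
    upper≡odds : + p ∣ ∏ H (λ i → even (H ℕ.+ i)) - ∏ H odd
    upper≡odds = subst (+ p ∣_) (cong₂ _-_ (sym (trans (∏-reverse H (λ i → even (H ℕ.+ i))) (∏-cong H upper-reflect))) signs-cancel)
                   (∏-congruent H (λ i → + p - odd i) (λ i → - + 1 * odd i)
                     (λ i _ → subst (+ p ∣_) (reduce (+ p) (odd i)) (D.∣m⇒∣m*n (+ 1) D.∣-refl)))
      where
      signs-cancel : ∏ H (λ i → - + 1 * odd i) ≡ ∏ H odd
      signs-cancel = trans (∏-*ˡ H (- + 1) odd) (trans (cong (_* ∏ H odd) (sign-even t)) (*-identityˡ (∏ H odd)))
      reduce : ∀ a o → a * + 1 ≡ a - o - - + 1 * o
      reduce = solve-∀
    p∣N![2^N-1] : + p ∣ factorial * ((+ 2) ^ N - + 1)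
    p∣N![2^N-1] = subst (+ p ∣_) rearrange (D.∣n⇒∣m*n evens upper≡odds)
      where
      rearrange : evens * (∏ H (λ i → even (H ℕ.+ i)) - ∏ H odd) ≡ factorial * ((+ 2) ^ N - + 1)
      rearrange =
        begin
          evens * (∏ H (λ i → even (H ℕ.+ i)) - ∏ H odd)
        ≡⟨ expand evens (∏ H (λ i → even (H ℕ.+ i))) (∏ H odd) ⟩
          evens * ∏ H (λ i → even (H ℕ.+ i)) - ∏ H odd * evens
        ≡⟨ cong₂ _-_ doubled factorial-split ⟨
          (+ 2) ^ N * factorial - factorial
        ≡⟨ factor ((+ 2) ^ N) factorial ⟩
          factorial * ((+ 2) ^ N - + 1)
        ∎
        where
        expand : ∀ a b c → a * (b - c) ≡ a * b - c * a
        expand = solve-∀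
        factor : ∀ x y → x * y - y ≡ y * (x - + 1)
        factor = solve-∀
    p∤N! : ¬ (+ p ∣ factorial)
    p∤N! = prime∤∏ pp N (λ i → + suc i) (λ i i<N → prime∤smaller i (factor-small i i<N))
      where
      factor-small : ∀ i → i ℕ.< N → suc i ℕ.< p
      factor-small i i<N = subst (suc i ℕ.<_) (sym p≡8t+1) (ℕ.s≤s (ℕP.≤-trans i<N (subst (ℕ._≤ t ℕ.* 8) (sym (N≡4t t)) (ℕP.*-monoʳ-≤ t (ℕP.m≤n+m 4 4)))))
    p∣2^N-1 : + p ∣ (+ 2) ^ N - + 1
    p∣2^N-1 = prime-cancelˡ pp factorial ((+ 2) ^ N - + 1) p∤N! p∣N![2^N-1]

  two-power-half : ∀ t p → Prime p → p ≡ suc (t ℕ.* 8) → + p ∣ (+ 2) ^ (t ℕ.* 4) - + 1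
  two-power-half t p pp p≡8t+1 = subst (λ e → + p ∣ (+ 2) ^ e - + 1) (N≡4t t) p∣2^N-1
    where open GaussLemma t p pp p≡8t+1

  ^-distribʳ-* : ∀ (a b : ℤ) n → (a * b) ^ n ≡ a ^ n * b ^ n
  ^-distribʳ-* a b zero = refl
  ^-distribʳ-* a b (suc n) rewrite ^-distribʳ-* a b n = interchange a b (a ^ n) (b ^ n)
    where
    interchange : ∀ a b x y → a * b * (x * y) ≡ a * x * (b * y)
    interchange = solve-∀

  *-pres-∣ : ∀ {a b x y} → a ∣ x → b ∣ y → a * b ∣ x * y
  *-pres-∣ {a} {b} (D.divides u x≡ua) (D.divides v y≡vb) = D.divides (u * v) (trans (cong₂ _*_ x≡ua y≡vb) (regroup u a v b))
    where
    regroup : ∀ u a v b → u * a * (v * b) ≡ u * v * (a * b)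
    regroup = solve-∀

  -- The first two terms of the binomial expansion of (p + i)^{K+1} modulo p².
  binomial-mod-p² : ∀ p K i → + p * + p ∣ (+ (p ℕ.+ i)) ^ suc K - (+ i) ^ suc K - + suc K * + p * (+ i) ^ K
  binomial-mod-p² p zero i = D.divides (+ 0) (trans (cong (λ z → z * + 1 - + i * + 1 - + 1 * + p * + 1) (pos-+ p i)) (vanish (+ p) (+ i)))
    where
    vanish : ∀ a b → (a + b) * + 1 - b * + 1 - + 1 * a * + 1 ≡ + 0 * (a * a)
    vanish = solve-∀
  binomial-mod-p² p (suc K) i with binomial-mod-p² p K i
  ... | D.divides Q e = D.divides (+ suc K * (+ i) ^ K + (+ p + + i) * Q)
          (trans (cong (λ z → z * (+ p + + i) ^ suc K - + i * (+ i) ^ suc K - + suc (suc K) * + p * (+ i * (+ i) ^ K)) (pos-+ p i))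
                 (next-power (+ p) (+ i) ((+ i) ^ K) Q (+ suc K) ((+ p + + i) ^ suc K)
                   (trans (cong (λ z → z ^ suc K - (+ i) ^ suc K - + suc K * + p * (+ i) ^ K) (sym (pos-+ p i))) e)))
    where
    next-power : ∀ a b bK Q k X → X - b * bK - k * a * bK ≡ Q * (a * a) →
                 (a + b) * X - b * (b * bK) - (+ 1 + k) * a * (b * bK) ≡ (k * bK + (a + b) * Q) * (a * a)
    next-power a b bK Q k X h =
      begin
        (a + b) * X - b * (b * bK) - (+ 1 + k) * a * (b * bK)
      ≡⟨ cong (λ z → (a + b) * z - b * (b * bK) - (+ 1 + k) * a * (b * bK)) (split-off X b bK k a) ⟩
        (a + b) * ((X - b * bK - k * a * bK) + b * bK + k * a * bK) - b * (b * bK) - (+ 1 + k) * a * (b * bK)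
      ≡⟨ cong (λ z → (a + b) * (z + b * bK + k * a * bK) - b * (b * bK) - (+ 1 + k) * a * (b * bK)) h ⟩
        (a + b) * (Q * (a * a) + b * bK + k * a * bK) - b * (b * bK) - (+ 1 + k) * a * (b * bK)
      ≡⟨ simplify a b bK Q k ⟩
        (k * bK + (a + b) * Q) * (a * a)
      ∎
      where
      split-off : ∀ X b bK k a → X ≡ (X - b * bK - k * a * bK) + b * bK + k * a * bK
      split-off = solve-∀
      simplify : ∀ a b bK Q k → (a + b) * (Q * (a * a) + b * bK + k * a * bK) - b * (b * bK) - (+ 1 + k) * a * (b * bK)
                                 ≡ (k * bK + (a + b) * Q) * (a * a)
      simplify = solve-∀

  -- Let M = n₁ + 2 with M + 1 < p and p ∣ 2^M - 1, and
  -- let P be the Appell polynomial of degree q = M + 1 of the Genocchi numbers.  Then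
  --   P(2p) - P(0) = 2q Σ_{i<p} ((2i+1)^M - (2i)^M)        (summing the step identity),
  --   P(2p) - P(0) = (2p)² R(2p) + 2p q G_M                 (expanding P),
  -- and the sum T on the first line is ≡ -2 (2^M - 1) S_p(M) + p M S_p(M-1) ≡ 0 (mod p²).
  -- Hence p² ∣ 2p q G_M, and p ∣ G_M since p ∤ 2q.
  module KummerCongruence (n₁ p : ℕ) (pp : Prime p) (M+1<p : suc (suc (suc n₁)) ℕ.< p)
                          (p∣2^M-1 : + p ∣ (+ 2) ^ suc (suc n₁) - + 1) where

    M : ℕ
    M = suc (suc n₁)
    q : ℕ
    q = suc M
    open Appell G (+ 2)

    step : ∀ x → P q ((x + + 1) + + 1) - P q x ≡ + 2 * + q * ((x + + 1) ^ M - x ^ M)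
    step = appell-step (suc n₁) (genocchi-recurrence (suc (suc n₁)))

    odd-power even-power : ℕ → ℤ
    odd-power i = (+ (i ℕ.* 2) + + 1) ^ M
    even-power i = (+ (i ℕ.* 2)) ^ M

    T : ℤ
    T = ∑ p (λ i → odd-power i - even-power i)

    telescoped : P q (+ (p ℕ.* 2)) - P q (+ 0) ≡ + 2 * + q * T
    telescoped =
      begin
        P q (+ (p ℕ.* 2)) - P q (+ 0)
      ≡⟨ ∑-telescope p (λ i → P q (+ (i ℕ.* 2))) ⟨
        ∑ p (λ i → P q (+ (suc i ℕ.* 2)) - P q (+ (i ℕ.* 2)))
      ≡⟨ ∑-cong p (λ i _ → trans (cong (λ z → P q (+ z) - P q (+ (i ℕ.* 2))) (next-even i)) (step (+ (i ℕ.* 2)))) ⟩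
        ∑ p (λ i → + 2 * + q * (odd-power i - even-power i))
      ≡⟨ ∑-*ˡ p (+ 2 * + q) (λ i → odd-power i - even-power i) ⟩
        + 2 * + q * T
      ∎
      where
      next-even : ∀ i → suc i ℕ.* 2 ≡ i ℕ.* 2 ℕ.+ 1 ℕ.+ 1
      next-even = ℕSolver.solve-∀

    -- Δ_i = (p + i)^M - i^M - M p i^{M-1}, divisible by p².
    Δ : ℕ → ℤ
    Δ i = (+ (p ℕ.+ i)) ^ M - (+ i) ^ M - + M * + p * (+ i) ^ suc n₁

    -- Σ_{j<2p} j^M computed in two ways: by parity of j, and as S_p(M) + Σ_{i<p} (p + i)^M.
    all-powers : ∑ p even-power + ∑ p odd-power ≡ powerSum p M + (∑ p Δ + powerSum p M + + M * + p * powerSum p (suc n₁))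
    all-powers =
      begin
        ∑ p even-power + ∑ p odd-power
      ≡⟨ ∑-+ p even-power odd-power ⟨
        ∑ p (λ i → even-power i + odd-power i)
      ≡⟨ ∑-cong p (λ i _ → cong (λ z → even-power i + (+ z) ^ M) (ℕP.+-comm (i ℕ.* 2) 1)) ⟩
        ∑ p (λ i → (+ (i ℕ.* 2)) ^ M + (+ suc (i ℕ.* 2)) ^ M)
      ≡⟨ ∑-pairs p (λ j → (+ j) ^ M) ⟨
        ∑ (p ℕ.* 2) (λ j → (+ j) ^ M)
      ≡⟨ cong (λ z → ∑ z (λ j → (+ j) ^ M)) (double p) ⟩
        ∑ (p ℕ.+ p) (λ j → (+ j) ^ M)
      ≡⟨ ∑-split p p (λ j → (+ j) ^ M) ⟩
        powerSum p M + ∑ p (λ i → (+ (p ℕ.+ i)) ^ M)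
      ≡⟨ cong (_+_ (powerSum p M)) (∑-cong p (λ i _ → split-off ((+ (p ℕ.+ i)) ^ M) ((+ i) ^ M) (+ M * + p * (+ i) ^ suc n₁))) ⟩
        powerSum p M + ∑ p (λ i → Δ i + (+ i) ^ M + + M * + p * (+ i) ^ suc n₁)
      ≡⟨ cong (_+_ (powerSum p M)) (trans (∑-+ p (λ i → Δ i + (+ i) ^ M) (λ i → + M * + p * (+ i) ^ suc n₁))
                                           (cong₂ _+_ (∑-+ p Δ (λ i → (+ i) ^ M)) (∑-*ˡ p (+ M * + p) (λ i → (+ i) ^ suc n₁)))) ⟩
        powerSum p M + (∑ p Δ + powerSum p M + + M * + p * powerSum p (suc n₁))
      ∎
      where
      double : ∀ p → p ℕ.* 2 ≡ p ℕ.+ p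
      double = ℕSolver.solve-∀
      split-off : ∀ x y z → x ≡ (x - y - z) + y + z
      split-off = solve-∀

    even-powers : ∑ p even-power ≡ (+ 2) ^ M * powerSum p M
    even-powers = trans (∑-cong p (λ i _ → trans (cong (_^ M) (trans (pos-* i 2) (*-comm (+ i) (+ 2)))) (^-distribʳ-* (+ 2) (+ i) M)))
                        (∑-*ˡ p ((+ 2) ^ M) (λ i → (+ i) ^ M))

    T-decomposition : T ≡ ∑ p Δ + (- + 2) * (((+ 2) ^ M - + 1) * powerSum p M) + + p * (+ M * powerSum p (suc n₁))
    T-decomposition =
      begin
        T
      ≡⟨ ∑-- p odd-power even-power ⟩
        ∑ p odd-power - ∑ p even-power
      ≡⟨ via-total (∑ p odd-power) (∑ p even-power) ⟩
        (∑ p even-power + ∑ p odd-power) - ∑ p even-power - ∑ p even-power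
      ≡⟨ cong₂ (λ u v → u - v - v) all-powers even-powers ⟩
        powerSum p M + (∑ p Δ + powerSum p M + + M * + p * powerSum p (suc n₁)) - (+ 2) ^ M * powerSum p M - (+ 2) ^ M * powerSum p M
      ≡⟨ collect (powerSum p M) (∑ p Δ) (+ M) (+ p) (powerSum p (suc n₁)) ((+ 2) ^ M) ⟩
        ∑ p Δ + (- + 2) * (((+ 2) ^ M - + 1) * powerSum p M) + + p * (+ M * powerSum p (suc n₁))
      ∎
      where
      via-total : ∀ o e → o - e ≡ (e + o) - e - e
      via-total = solve-∀
      collect : ∀ s d m p s′ t → s + (d + s + m * p * s′) - t * s - t * s ≡ d + (- + 2) * ((t - + 1) * s) + p * (m * s′)
      collect = solve-∀

    -- Each part of the decomposition is divisible by p²: the Δ_i by the binomial expansion,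
    -- the other two since p divides 2^M - 1, S_p(M) and S_p(M - 1).
    p²∣T : + p * + p ∣ T
    p²∣T = subst (+ p * + p ∣_) (sym T-decomposition)
      (D.∣m∣n⇒∣m+n (D.∣m∣n⇒∣m+n (∑-∣ p (λ i _ → binomial-mod-p² p (suc n₁) i))
                                 (D.∣n⇒∣m*n (- + 2) (*-pres-∣ p∣2^M-1 (powerSum-divisible pp (suc n₁) M+1<p))))
                   (*-pres-∣ (D.∣-refl {+ p}) (D.∣n⇒∣m*n (+ M) (powerSum-divisible pp n₁ (ℕP.<-trans (ℕP.n<1+n _) M+1<p)))))

    p²∣R : + p * + p ∣ + (p ℕ.* 2) * + (p ℕ.* 2) * R (suc n₁) (+ (p ℕ.* 2))
    p²∣R = subst (+ p * + p ∣_) (trans (regroup (+ p) R₂ₚ) (cong (λ z → z * z * R₂ₚ) (sym (pos-* p 2))))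
                 (D.∣m⇒∣m*n (+ 4 * R₂ₚ) (D.∣-refl {+ p * + p}))
      where
      R₂ₚ : ℤ
      R₂ₚ = R (suc n₁) (+ (p ℕ.* 2))
      regroup : ∀ a y → a * a * (+ 4 * y) ≡ a * + 2 * (a * + 2) * y
      regroup = solve-∀

    key : + p * (+ 2 * (+ q * G M)) ≡ + 2 * + q * T - + (p ℕ.* 2) * + (p ℕ.* 2) * R (suc n₁) (+ (p ℕ.* 2))
    key =
      begin
        + p * (+ 2 * (+ q * G M))
      ≡⟨ rotate (+ p) (+ q * G M) ⟩
        + q * G M * (+ p * + 2)
      ≡⟨ cong (+ q * G M *_) (pos-* p 2) ⟨
        + q * G M * + (p ℕ.* 2)
      ≡⟨ isolate (+ (p ℕ.* 2) * + (p ℕ.* 2) * R (suc n₁) (+ (p ℕ.* 2))) (+ q * G M * + (p ℕ.* 2)) ⟩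
        (+ (p ℕ.* 2) * + (p ℕ.* 2) * R (suc n₁) (+ (p ℕ.* 2)) + + q * G M * + (p ℕ.* 2)) - + (p ℕ.* 2) * + (p ℕ.* 2) * R (suc n₁) (+ (p ℕ.* 2))
      ≡⟨ cong (_- + (p ℕ.* 2) * + (p ℕ.* 2) * R (suc n₁) (+ (p ℕ.* 2))) (trans (sym (P-sub-constant (suc n₁) (+ (p ℕ.* 2)))) telescoped) ⟩
        + 2 * + q * T - + (p ℕ.* 2) * + (p ℕ.* 2) * R (suc n₁) (+ (p ℕ.* 2))
      ∎
      where
      rotate : ∀ a y → a * (+ 2 * y) ≡ y * (a * + 2)
      rotate = solve-∀
      isolate : ∀ x y → y ≡ (x + y) - x
      isolate = solve-∀

    result : + p ∣ G M
    result = prime-cancelˡ pp (+ q) (G M) (prime∤smaller M M+1<p)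
               (prime-cancelˡ pp (+ 2) (+ q * G M) (prime∤smaller 1 2<p) p∣2qG)
      where
      instance
        p≢0 : ℤ.NonZero (+ p)
        p≢0 = prime⇒nonZero pp
      2<p : 2 ℕ.< p
      2<p = ℕP.<-trans (ℕ.s≤s (ℕ.s≤s (ℕ.s≤s ℕ.z≤n))) M+1<p
      p∣2qG : + p ∣ + 2 * (+ q * G M)
      p∣2qG = D.*-cancelˡ-∣ (+ p) (subst (+ p * + p ∣_) (sym key) (D.∣m∣n⇒∣m-n (D.∣n⇒∣m*n (+ 2 * + q) p²∣T) p²∣R))

  genocchi-divisible : ∀ {p} M → Prime p → 2 ℕ.≤ M → suc M ℕ.< p → + p ∣ (+ 2) ^ M - + 1 → + p ∣ G M
  genocchi-divisible zero _ () _ _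
  genocchi-divisible (suc zero) _ (ℕ.s≤s ()) _ _
  genocchi-divisible (suc (suc n₁)) pp _ M+1<p p∣2^M-1 = KummerCongruence.result n₁ _ pp M+1<p p∣2^M-1

  -- A prime p ≡ 1 (mod 8) has the form 8t + 9 (it is not 1).
  prime-1-mod-8 : ∀ {p} → Prime p → p ℕ.% 8 ≡ 1 → ∃[ t ] p ≡ suc (suc t ℕ.* 8)
  prime-1-mod-8 {p} pp p%8≡1 with p ℕ./ 8 | m≡m%n+[m/n]*n p 8
  ... | zero | p≡p%8 = ⊥-elim (¬prime[1] (subst Prime (trans p≡p%8 (cong (ℕ._+ 0) p%8≡1)) pp))
  ... | suc t | p≡p%8+8t = t , trans p≡p%8+8t (cong (ℕ._+ suc t ℕ.* 8) p%8≡1)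

open import Data.Nat using (ℕ; _+_; _*_; _%_; _≤_)
open import Data.Nat.Primality using (Prime)
open import Data.Integer using (+_)
open import Data.Integer.Divisibility using (_∣_)
open import Data.Product using (∃-syntax; _×_)
open import Relation.Binary.PropositionalEquality using (_≡_)

open import Data.Nat using (suc; z≤n; s≤s)
import Data.Nat.Properties as ℕP
import Data.Nat.Tactic.RingSolver as ℕSolver
open import Data.Integer.Divisibility.Signed using (∣⇒∣ᵤ) renaming (_∣_ to _∣ₛ_)
open import Data.Product using (_,_)
open import Relation.Binary.PropositionalEquality using (subst; sym)
open GenocchiDivisibility using (prime-1-mod-8; two-power-half; genocchi-divisible)

-- Writing p = 8t + 9, the index k = 2t + 2 gives 2k = 4t + 4 = (p - 1)/2, and
-- p ∣ 2^{(p-1)/2} - 1 by Gauss's lemma, so the Kummer-type congruence applies.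
corollary1p9 : (p : ℕ) → Prime p → p % 8 ≡ 1 →
    ∃[ k ] (1 ≤ k × 2 * k + 3 ≤ p × (+ p) ∣ genocchi (2 * k))
corollary1p9 p pp p%8≡1 with prime-1-mod-8 pp p%8≡1
... | t , p≡8t+9 = suc t * 2 , s≤s z≤n , below-p (2 * (suc t * 2) + 3) (t * 4 + 2) (arith₁ t) ,
                   subst (λ m → (+ p) ∣ genocchi m) (sym (arith₂ t)) (∣⇒∣ᵤ p∣G)
  where
  below-p : ∀ a b → a + b ≡ suc (suc t * 8) → a ≤ p
  below-p a b a+b≡p = subst (a ≤_) (sym p≡8t+9) (subst (a ≤_) a+b≡p (ℕP.m≤m+n a b))
  arith₁ : ∀ t → 2 * (suc t * 2) + 3 + (t * 4 + 2) ≡ suc (suc t * 8)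
  arith₁ = ℕSolver.solve-∀
  arith₂ : ∀ t → 2 * (suc t * 2) ≡ suc t * 4
  arith₂ = ℕSolver.solve-∀
  arith₃ : ∀ t → suc (suc (suc t * 4)) + (t * 4 + 3) ≡ suc (suc t * 8)
  arith₃ = ℕSolver.solve-∀
  p∣G : + p ∣ₛ genocchi (suc t * 4)
  p∣G = genocchi-divisible (suc t * 4) pp (s≤s (s≤s z≤n)) (below-p (suc (suc (suc t * 4))) (t * 4 + 3) (arith₃ t))
                           (two-power-half (suc t) p pp p≡8t+9)
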